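{- Let $p$ be an odd prime and let $f:\mathbb{F}_{p^2}\to\mathbb{F}_{p^2}$ be a planar function with $f(1)=1$ such that $f(\lambda x)=\lambda^d f(x)$ for all $\lambda\in\mathbb{F}_p$, $x\in\mathbb{F}_{p^2}$, for some fixed positive integer $d$. Let $T$ be a complete set of coset representatives of $\mathbb{F}_p^*$ in $\mathbb{F}_{p^2}^*$, let $\beta\in\mathbb{F}_{p^2}^*$ satisfy $\beta^{p-1}=-1$, and for $a\in\mathbb{F}_{p^2}^*$ let $Z_a=\{z\in T:\mathrm{Tr}(af(z))=0\}$. Then: (1) for each $a\neq 0$, $|Z_a|\in\{0,2\}$; (2) for each $x\in\mathbb{F}_{p^2}^*$ there exists $x^*\in\mathbb{F}_{p^2}^*$, unique up to sign, such that $f(x)=\beta^2 f(x^*)$.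
   Context: $\mathrm{Tr}$ denotes the trace from $\mathbb{F}_{p^2}$ to $\mathbb{F}_p$. A function $f:\mathbb{F}_q\to\mathbb{F}_q$ is planar if for every $a\in\mathbb{F}_q^*$ the map $x\mapsto f(x+a)-f(x)-f(a)$ is a permutation of $\mathbb{F}_q$. Note $\beta^2$ is a nonsquare in $\mathbb{F}_p^*$. -}

module Defs where

open import Data.Nat using (ℕ; zero; suc; NonZero; _∸_) renaming (_+_ to _+ℕ_; _*_ to _*ℕ_)
open import Data.Nat.DivMod using (_mod_)
open import Data.Fin using (Fin; toℕ)
open import Data.Product using (_×_; _,_; Σ; ∃; proj₁; proj₂)
open import Data.List using (List; length; filter)
open import Data.List.Membership.Propositional using (_∈_)
open import Data.List.Relation.Unary.Unique.Propositional using (Unique)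
open import Relation.Binary.PropositionalEquality using (_≡_; _≢_)
open import Function.Definitions using (Bijective)
import Data.Fin as Fin
open import Data.Product.Properties using (≡-dec)
open import Relation.Nullary using (Dec)

-- F_p  = Fin p with arithmetic mod p.
-- F_{p^2} = F_p[ω]/(ω² - w), pairs (a , b) ↦ a + b ω, where w is a
-- nonsquare mod p (a hypothesis imposed in the statement).
module FF (p : ℕ) .{{_ : NonZero p}} (w : ℕ) where

  Fp : Set
  Fp = Fin p

  F : Set
  F = Fp × Fp

  [_]ₚ : ℕ → Fp
  [ k ]ₚ = k mod p

  NonSquareW : Set
  NonSquareW = (y : Fp) → [ toℕ y *ℕ toℕ y ]ₚ ≢ [ w ]ₚ

  0F : F
  0F = ([ 0 ]ₚ , [ 0 ]ₚ)

  1F : F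
  1F = ([ 1 ]ₚ , [ 0 ]ₚ)

  ι : Fp → F
  ι λ′ = (λ′ , [ 0 ]ₚ)

  infixl 6 _+_ _-_
  infixl 7 _*_
  infixr 8 _^_

  _+_ : F → F → F
  (a , b) + (c , d) = ([ toℕ a +ℕ toℕ c ]ₚ , [ toℕ b +ℕ toℕ d ]ₚ)

  -_ : F → F
  - (a , b) = ([ p ∸ toℕ a ]ₚ , [ p ∸ toℕ b ]ₚ)

  _-_ : F → F → F
  x - y = x + (- y)

  _*_ : F → F → F
  (a , b) * (c , d) =
    ( [ toℕ a *ℕ toℕ c +ℕ w *ℕ (toℕ b *ℕ toℕ d) ]ₚ
    , [ toℕ a *ℕ toℕ d +ℕ toℕ b *ℕ toℕ c ]ₚ )

  _^_ : F → ℕ → F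
  x ^ zero  = 1F
  x ^ suc k = x * (x ^ k)

  Tr : F → F
  Tr x = x + x ^ p

  Planar : (F → F) → Set
  Planar f = (a : F) → a ≢ 0F → Bijective _≡_ _≡_ (λ x → f (x + a) - f x - f a)

  CosetReps : List F → Set
  CosetReps T =
      Unique T
    × ((t : F) → t ∈ T → t ≢ 0F)
    × ((y : F) → y ≢ 0F → Σ F λ t → t ∈ T × Σ Fp λ μ → ι μ ≢ 0F × y ≡ ι μ * t)
    × ((t t′ : F) → t ∈ T → t′ ∈ T → (μ : Fp) → t′ ≡ ι μ * t → t′ ≡ t)

  _≟F_ : (x y : F) → Dec (x ≡ y)
  _≟F_ = ≡-dec Fin._≟_ Fin._≟_

  Z : (F → F) → List F → F → List F
  Z f T a = filter (λ z → Tr (a * f z) ≟F 0F) T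

{-# OPTIONS --safe #-}
-- F_{p²} is F_p(ω) with ω² = w. Since β^{p-1} = -1, the Frobenius x ↦ x^p is not the identity,
-- hence it is the conjugation a + bω ↦ a - bω, and Tr(u) = 0 exactly when u has real part 0.
-- Planarity makes Δᵤ(x) = f(x+u) - f(x) - f(u) injective for u ≠ 0; with homogeneity this forces d
-- to be even, f(-x) = f(x), and f(y) = f(y′) only for y = ±y′.
-- Fix a ≠ 0 and let G(y) be the real part of a·f(y). For a zero z ≠ 0 of G, a·Δ_{μz} maps the line
-- F_p z injectively into, hence onto, the imaginary axis, so G(x + μz) = G(x) with μ ≠ 0 only for x on
-- that line. Hence every parallel to F_p z contains exactly one zero of G and all zeros lie on two
-- lines; T meets each line once, so |Z_a| ∈ {0, 2}.
-- For (2) pick a with a·f(x) = ω and let a·f(z) = rω for z on the second line of zeros. The values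
-- l^d·ω and k^d·r·ω of a·f on the two lines are disjoint since f is two-to-one, so 1/r = w·λ^d;
-- as β = bω with b² = κ^d, the point x* = (λ/κ)z satisfies f(x) = β²f(x*).
module Submission where

open import Defs
open import Data.Nat using (ℕ; NonZero; _≤_; _∸_)
open import Data.Nat.Primality using (Prime)
open import Data.Product using (_×_; _,_; Σ)
open import Data.Sum using (_⊎_)
open import Data.List using (List; length)
open import Relation.Binary.PropositionalEquality using (_≡_; _≢_)

open import Level using (0ℓ)
open import Data.Nat as ℕ using (zero; suc; _!; _<_)
import Data.Nat.Properties as ℕ
open import Data.Nat.DivMod using (_mod_; _%_; %-distribˡ-+; %-distribˡ-*; m<n⇒m%n≡m; m/n*n≡m)
open import Data.Nat.Divisibility using (_∣_; divides; ∣-refl; ∣1⇒≡1; ∣⇒≤; >⇒∤; m∣m*n; n∣m⇒m%n≡0; m%n≡0⇒n∣m)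
open import Data.Nat.Primality using (euclidsLemma; prime⇒nonZero; prime⇒nonTrivial)
open import Data.Nat.Combinatorics using (_C_; nCn≡1; k![n∸k]!∣n!; nCk≡n!/k![n-k]!)
open import Data.Fin as Fin using (Fin; toℕ; fromℕ; inject₁; punchOut)
open import Data.Fin.Properties
  using (toℕ-injective; toℕ-fromℕ<; toℕ<n; toℕ-fromℕ; toℕ-inject₁; any?; _≟_; punchOut-injective; injective⇒≤)
open import Data.Integer using (0ℤ; 1ℤ)
open import Data.Product using (∃; proj₁; proj₂; map₂)
open import Data.Product.Properties using (,-injectiveˡ; ,-injectiveʳ)
open import Data.Sum as Sum using (inj₁; inj₂; reduce)
open import Data.Empty using (⊥; ⊥-elim)
open import Data.List using ([]; _∷_)
open import Data.List.Membership.Propositional using (_∈_)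
open import Data.List.Membership.Propositional.Properties using (∈-filter⁺; ∈-filter⁻)
open import Data.List.Relation.Unary.Any as Any using (here; there)
open import Data.List.Relation.Unary.All as All using (_∷_)
open import Data.List.Relation.Unary.AllPairs using (_∷_)
open import Data.List.Relation.Unary.Unique.Propositional using (Unique)
import Data.List.Relation.Unary.Unique.Propositional.Properties as Unique
open import Relation.Nullary using (¬_; Dec; yes; no)
open import Relation.Binary.PropositionalEquality
  using (refl; sym; trans; cong; cong₂; subst; isEquivalence; module ≡-Reasoning)
open import Function using (id)
open import Function.Definitions using (Injective)
open import Algebra.Bundles using (Semiring; CommutativeSemiring; CommutativeRing)
import Algebra.Properties.Semiring.Mult as SemiringMult
import Algebra.Solver.Ring.AlmostCommutativeRing as ACR

Fin-injective⇒surjective : ∀ {n} (f : Fin n → Fin n) → Injective _≡_ _≡_ f → ∀ y → ∃ λ x → f x ≡ y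
Fin-injective⇒surjective {zero} f f-inj ()
Fin-injective⇒surjective {suc m} f f-inj y with any? (λ x → f x ≟ y)
... | yes hit = hit
... | no miss = ⊥-elim (ℕ.<-irrefl refl (injective⇒≤ {f = g} g-inj))
  where
  y≢f : ∀ x → y ≢ f x
  y≢f x y≡fx = miss (x , sym y≡fx)
  g : Fin (suc m) → Fin m
  g x = punchOut (y≢f x)
  g-inj : Injective _≡_ _≡_ g
  g-inj e = f-inj (punchOut-injective (y≢f _) (y≢f _) e)

mkCommutativeRing : {A : Set} (_+_ _*_ : A → A → A) (-_ : A → A) (0# 1# : A)
  → (∀ x y z → (x + y) + z ≡ x + (y + z))
  → (∀ x y → x + y ≡ y + x)
  → (∀ x → 0# + x ≡ x)
  → (∀ x → (- x) + x ≡ 0#)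
  → (∀ x y z → (x * y) * z ≡ x * (y * z))
  → (∀ x y → x * y ≡ y * x)
  → (∀ x → 1# * x ≡ x)
  → (∀ x y z → x * (y + z) ≡ (x * y) + (x * z))
  → CommutativeRing 0ℓ 0ℓ
mkCommutativeRing {A} _+_ _*_ -_ 0# 1# +-assoc +-comm +-identityˡ -‿inverseˡ *-assoc *-comm *-identityˡ distribˡ = record
  { Carrier = A ; _≈_ = _≡_ ; _+_ = _+_ ; _*_ = _*_ ; -_ = -_ ; 0# = 0# ; 1# = 1#
  ; isCommutativeRing = record
    { isRing = record
      { +-isAbelianGroup = record
        { isGroup = record
          { isMonoid = record
            { isSemigroup = record
              { isMagma = record { isEquivalence = isEquivalence ; ∙-cong = cong₂ _+_ }
              ; assoc = +-assoc }
            ; identity = +-identityˡ , λ x → trans (+-comm x 0#) (+-identityˡ x) }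
          ; inverse = -‿inverseˡ , λ x → trans (+-comm x (- x)) (-‿inverseˡ x)
          ; ⁻¹-cong = cong -_ }
        ; comm = +-comm }
      ; *-cong = cong₂ _*_
      ; *-assoc = *-assoc
      ; *-identity = *-identityˡ , λ x → trans (*-comm x 1#) (*-identityˡ x)
      ; distrib = distribˡ , λ x y z → trans (*-comm (y + z) x)
                    (trans (distribˡ x y z) (cong₂ _+_ (*-comm x y) (*-comm x z)))
      }
    ; *-comm = *-comm }
  }

-- The ring solver normalises coefficients with a decision procedure; residues modulo a variable p
-- cannot be compared by computation, so coefficients are taken in ℤ. The optimised _×′_ makes
-- ⟦ 1ℤ ⟧ definitionally 1#, so that con 1ℤ denotes the ring's own unit.
module IntegerCoefficients {c ℓ} (R : CommutativeRing c ℓ) where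
  open import Data.Integer as ℤ using (ℤ; +_; -[1+_]; _⊖_; sign; ∣_∣)
  open import Data.Integer.Properties as ℤ using ([1+m]⊖[1+n]≡m⊖n)
  open import Data.Sign as Sign using (Sign)
  open import Data.Maybe using (Maybe; just; nothing)
  open CommutativeRing R renaming (refl to ≈-refl; sym to ≈-sym; trans to ≈-trans)
  open import Algebra.Properties.Ring ring using (-0#≈0#; -‿involutive; -‿+-comm; xyx⁻¹≈y; -‿distribˡ-*; -‿distribʳ-*)
  open import Algebra.Properties.Semiring.Mult.TCOptimised semiring using (×-homo-+; ×1-homo-*; ×-cong; 1+×) renaming (_×_ to _×′_)
  open import Relation.Binary.Reasoning.Setoid setoid

  signed : Sign → Carrier → Carrier
  signed Sign.+ x = x
  signed Sign.- x = - x

  signed-cong : ∀ s {x y} → x ≈ y → signed s x ≈ signed s y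
  signed-cong Sign.+ x≈y = x≈y
  signed-cong Sign.- x≈y = -‿cong x≈y

  signed-* : ∀ s t x y → signed (s Sign.* t) (x * y) ≈ signed s x * signed t y
  signed-* Sign.+ Sign.+ x y = ≈-refl
  signed-* Sign.+ Sign.- x y = -‿distribʳ-* x y
  signed-* Sign.- Sign.+ x y = -‿distribˡ-* x y
  signed-* Sign.- Sign.- x y = begin
    x * y          ≈⟨ -‿involutive (x * y) ⟨
    - - (x * y)    ≈⟨ -‿cong (-‿distribʳ-* x y) ⟩
    - (x * - y)    ≈⟨ -‿distribˡ-* x (- y) ⟩
    - x * - y      ∎

  ⟦_⟧ : ℤ → Carrier
  ⟦ i ⟧ = signed (sign i) (∣ i ∣ ×′ 1#)

  ◃-homo : ∀ s n → ⟦ s ℤ.◃ n ⟧ ≈ signed s (n ×′ 1#)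
  ◃-homo Sign.+ zero    = ≈-refl
  ◃-homo Sign.+ (suc n) = ≈-refl
  ◃-homo Sign.- zero    = ≈-sym -0#≈0#
  ◃-homo Sign.- (suc n) = ≈-refl

  *-homo : ∀ i j → ⟦ i ℤ.* j ⟧ ≈ ⟦ i ⟧ * ⟦ j ⟧
  *-homo i j = begin
    ⟦ i ℤ.* j ⟧                                   ≈⟨ ◃-homo (sign i Sign.* sign j) (∣ i ∣ ℕ.* ∣ j ∣) ⟩
    signed (sign i Sign.* sign j) ((∣ i ∣ ℕ.* ∣ j ∣) ×′ 1#)
      ≈⟨ signed-cong (sign i Sign.* sign j) (×1-homo-* ∣ i ∣ ∣ j ∣) ⟩
    signed (sign i Sign.* sign j) (∣ i ∣ ×′ 1# * ∣ j ∣ ×′ 1#) ≈⟨ signed-* (sign i) (sign j) _ _ ⟩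
    ⟦ i ⟧ * ⟦ j ⟧                                 ∎

  -‿homo : ∀ i → ⟦ ℤ.- i ⟧ ≈ - ⟦ i ⟧
  -‿homo (+ zero)  = ≈-sym -0#≈0#
  -‿homo (+ suc n) = ≈-refl
  -‿homo -[1+ n ]  = ≈-sym (-‿involutive _)

  ⊖-homo : ∀ m n → ⟦ m ⊖ n ⟧ ≈ m ×′ 1# - n ×′ 1#
  ⊖-homo m       zero    = ≈-sym (≈-trans (+-congˡ -0#≈0#) (+-identityʳ _))
  ⊖-homo zero    (suc n) = ≈-sym (+-identityˡ _)
  ⊖-homo (suc m) (suc n) = begin
    ⟦ suc m ⊖ suc n ⟧                    ≡⟨ cong ⟦_⟧ ([1+m]⊖[1+n]≡m⊖n m n) ⟩
    ⟦ m ⊖ n ⟧                            ≈⟨ ⊖-homo m n ⟩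
    m ×′ 1# - n ×′ 1#                      ≈⟨ +-congʳ (xyx⁻¹≈y 1# (m ×′ 1#)) ⟨
    1# + m ×′ 1# + - 1# - n ×′ 1#          ≈⟨ +-assoc _ _ _ ⟩
    1# + m ×′ 1# + (- 1# - n ×′ 1#)        ≈⟨ +-congˡ (-‿+-comm 1# (n ×′ 1#)) ⟩
    1# + m ×′ 1# - (1# + n ×′ 1#)          ≈⟨ +-cong (1+× m 1#) (-‿cong (1+× n 1#)) ⟨
    suc m ×′ 1# - suc n ×′ 1#              ∎

  +-homo : ∀ i j → ⟦ i ℤ.+ j ⟧ ≈ ⟦ i ⟧ + ⟦ j ⟧
  +-homo (+ m)    (+ n)    = ×-homo-+ 1# m n
  +-homo (+ m)    -[1+ n ] = ⊖-homo m (suc n)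
  +-homo -[1+ m ] (+ n)    = ≈-trans (⊖-homo n (suc m)) (+-comm _ _)
  +-homo -[1+ m ] -[1+ n ] = begin
    - (suc (suc (m ℕ.+ n)) ×′ 1#)          ≈⟨ -‿cong (×-cong (cong suc (ℕ.+-suc m n)) ≈-refl) ⟨
    - ((suc m ℕ.+ suc n) ×′ 1#)            ≈⟨ -‿cong (×-homo-+ 1# (suc m) (suc n)) ⟩
    - (suc m ×′ 1# + suc n ×′ 1#)           ≈⟨ -‿+-comm _ _ ⟨
    - (suc m ×′ 1#) + - (suc n ×′ 1#)       ∎

  morphism : ℤ.+-*-rawRing ACR.-Raw-AlmostCommutative⟶ ACR.fromCommutativeRing R
  morphism = record
    { ⟦_⟧ = ⟦_⟧ ; +-homo = +-homo ; *-homo = *-homo ; -‿homo = -‿homo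
    ; 0-homo = ≈-refl ; 1-homo = ≈-refl }

  ⟦⟧-≟ : ∀ i j → Maybe (⟦ i ⟧ ≈ ⟦ j ⟧)
  ⟦⟧-≟ i j with i ℤ.≟ j
  ... | yes i≡j = just (reflexive (cong ⟦_⟧ i≡j))
  ... | no  _   = nothing

  open import Algebra.Solver.Ring ℤ.+-*-rawRing (ACR.fromCommutativeRing R) morphism ⟦⟧-≟ public
    using (solve; _:=_; _:+_; _:*_; _:-_; :-_; con)

module _ {A : Set} where

  length≡1 : ∀ {xs : List A} → Unique xs → ∀ {b} → b ∈ xs → (∀ {x} → x ∈ xs → x ≡ b) → length xs ≡ 1
  length≡1 {_ ∷ []}    _               _   _     = refl
  length≡1 {y ∷ z ∷ _} ((y≢z ∷ _) ∷ _) _   all-b =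
    ⊥-elim (y≢z (trans (all-b (here refl)) (sym (all-b (there (here refl))))))

  length≡2 : ∀ {xs : List A} → Unique xs → ∀ {a b} → a ≢ b → a ∈ xs → b ∈ xs
    → (∀ {x} → x ∈ xs → x ≡ a ⊎ x ≡ b) → length xs ≡ 2
  length≡2 {y ∷ ys} (y∉ys ∷ ys-unique) {a} {b} a≢b a∈ b∈ a-or-b with a-or-b (here refl)
  ... | inj₁ refl = cong suc (length≡1 ys-unique (Any.tail (λ b≡y → a≢b (sym b≡y)) b∈)
    (λ x∈ys → Sum.[ (λ x≡y → ⊥-elim (All.lookup y∉ys x∈ys (sym x≡y))) , id ]′ (a-or-b (there x∈ys))))
  ... | inj₂ refl = cong suc (length≡1 ys-unique (Any.tail a≢b a∈)
    (λ x∈ys → Sum.[ id , (λ x≡y → ⊥-elim (All.lookup y∉ys x∈ys (sym x≡y))) ]′ (a-or-b (there x∈ys))))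

prime∤! : ∀ {p} → Prime p → ∀ m → m < p → ¬ (p ∣ m !)
prime∤! p-prime zero    m<p p∣1 = ℕ.<-irrefl (sym (∣1⇒≡1 p∣1)) (ℕ.nonTrivial⇒n>1 _)
  where instance _ = prime⇒nonTrivial p-prime
prime∤! p-prime (suc m) m<p p∣m! with euclidsLemma (suc m) (m !) p-prime p∣m!
... | inj₁ p∣1+m = >⇒∤ m<p p∣1+m
... | inj₂ p∣m!  = prime∤! p-prime m (ℕ.<-trans (ℕ.n<1+n m) m<p) p∣m!

prime∣C : ∀ {p k} → Prime p → 0 < k → k < p → p ∣ p C k
prime∣C {p} {k} p-prime 0<k k<p
  with euclidsLemma (p C k) (k ! ℕ.* (p ℕ.∸ k) !) p-prime (subst (p ∣_) (sym C*k![p∸k]!≡p!) p∣p!)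
  where
  instance _ = ℕ._!*_!≢0 k (p ℕ.∸ k)
  instance _ = prime⇒nonZero p-prime
  C*k![p∸k]!≡p! : (p C k) ℕ.* (k ! ℕ.* (p ℕ.∸ k) !) ≡ p !
  C*k![p∸k]!≡p! = trans (cong (λ c → c ℕ.* (k ! ℕ.* (p ℕ.∸ k) !)) (nCk≡n!/k![n-k]! (ℕ.<⇒≤ k<p)))
    (m/n*n≡m (k![n∸k]!∣n! (ℕ.<⇒≤ k<p)))
  p∣p! : p ∣ p !
  p∣p! = subst (λ n → n ∣ n !) (ℕ.suc-pred p) (m∣m*n (ℕ.pred p !))
... | inj₁ p∣C = p∣C
... | inj₂ p∣k![p∸k]! with euclidsLemma (k !) ((p ℕ.∸ k) !) p-prime p∣k![p∸k]!
... | inj₁ p∣k!     = ⊥-elim (prime∤! p-prime k k<p p∣k!)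
... | inj₂ p∣[p∸k]! = ⊥-elim (prime∤! p-prime (p ℕ.∸ k) (ℕ.∸-monoʳ-< 0<k (ℕ.<⇒≤ k<p)) p∣[p∸k]!)

module _ {c ℓ} (S : Semiring c ℓ) where
  open Semiring S using (1#; _*_; _≈_; *-identityˡ) renaming (refl to ≈-refl; trans to ≈-trans)
  open import Algebra.Properties.Semiring.Exp S using (_^_)

  1#^n≈1# : ∀ n → 1# ^ n ≈ 1#
  1#^n≈1# zero    = ≈-refl
  1#^n≈1# (suc n) = ≈-trans (*-identityˡ _) (1#^n≈1# n)

module SemiringBinomial {c ℓ} (R : CommutativeSemiring c ℓ) where
  open CommutativeSemiring R renaming (refl to ≈-refl; sym to ≈-sym; trans to ≈-trans)
  open import Algebra.Properties.Semiring.Mult semiring using (×-assoc-*; ×1-homo-*; ×-congʳ) renaming (_×_ to _×′_)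
  open import Algebra.Properties.Semiring.Exp semiring using (_^_)
  open import Algebra.Properties.Monoid.Sum +-monoid using (sum; sum-init-last; sum-cong-≋; sum-replicate-zero)
  import Algebra.Properties.CommutativeSemiring.Binomial R as Binomial
  open import Relation.Binary.Reasoning.Setoid setoid

  binomial-without-middle : ∀ n .{{_ : NonZero n}}
    → (∀ k t → 0 < k → k < n → (n C k) ×′ t ≈ 0#)
    → ∀ x y → (x + y) ^ n ≈ x ^ n + y ^ n
  binomial-without-middle n@(suc q) middle x y = begin
    (x + y) ^ n                                        ≈⟨ Binomial.theorem n x y ⟩
    T Fin.zero + sum (λ i → T (Fin.suc i))             ≈⟨ +-congˡ (sum-init-last (λ i → T (Fin.suc i))) ⟩
    T Fin.zero + (sum (λ i → T (Fin.suc (inject₁ i))) + T (Fin.suc (fromℕ q)))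
      ≈⟨ +-congˡ (+-congʳ (≈-trans (sum-cong-≋ middle-terms) (sum-replicate-zero q))) ⟩
    T Fin.zero + (0# + T (Fin.suc (fromℕ q)))          ≈⟨ +-cong first-term (≈-trans (+-identityˡ _) last-term) ⟩
    y ^ n + x ^ n                                      ≈⟨ +-comm _ _ ⟩
    x ^ n + y ^ n                                      ∎
    where
    T : Fin (suc n) → Carrier
    T = Binomial.binomialTerm x y n
    first-term : T Fin.zero ≈ y ^ n
    first-term = ≈-trans (+-identityʳ _) (*-identityˡ _)
    last-term : T (Fin.suc (fromℕ q)) ≈ x ^ n
    last-term = begin
      T (Fin.suc (fromℕ q))               ≡⟨ cong (λ k → (n C k) ×′ (x ^ k * y ^ (n ℕ.∸ k))) (cong suc (toℕ-fromℕ q)) ⟩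
      (n C n) ×′ (x ^ n * y ^ (n ℕ.∸ n))   ≡⟨ cong₂ (λ c k → c ×′ (x ^ n * y ^ k)) (nCn≡1 n) (ℕ.n∸n≡0 n) ⟩
      1 ×′ (x ^ n * 1#)                    ≈⟨ +-identityʳ _ ⟩
      x ^ n * 1#                          ≈⟨ *-identityʳ _ ⟩
      x ^ n                               ∎
    middle-terms : ∀ i → T (Fin.suc (inject₁ i)) ≈ 0#
    middle-terms i = middle _ _ (ℕ.s≤s ℕ.z≤n) (ℕ.s≤s (subst (_< q) (sym (toℕ-inject₁ i)) (toℕ<n i)))

  module CharacteristicP {p} (p-prime : Prime p) (p×1≈0 : p ×′ 1# ≈ 0#) where
    instance _ = prime⇒nonZero p-prime

    ×-vanishes : ∀ {n} x → p ∣ n → n ×′ x ≈ 0#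
    ×-vanishes x (divides q refl) = begin
      (q ℕ.* p) ×′ x              ≈⟨ ×-congʳ (q ℕ.* p) (*-identityˡ x) ⟨
      (q ℕ.* p) ×′ (1# * x)       ≈⟨ ×-assoc-* (q ℕ.* p) 1# x ⟨
      ((q ℕ.* p) ×′ 1#) * x       ≈⟨ *-congʳ (×1-homo-* q p) ⟩
      ((q ×′ 1#) * (p ×′ 1#)) * x  ≈⟨ *-congʳ (*-congˡ p×1≈0) ⟩
      ((q ×′ 1#) * 0#) * x        ≈⟨ *-congʳ (zeroʳ _) ⟩
      0# * x                     ≈⟨ zeroˡ x ⟩
      0#                         ∎

    freshman's-dream : ∀ x y → (x + y) ^ p ≈ x ^ p + y ^ p
    freshman's-dream = binomial-without-middle p
      (λ k t 0<k k<p → ×-vanishes t (prime∣C p-prime 0<k k<p))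

    fermat : ∀ n → (n ×′ 1#) ^ p ≈ n ×′ 1#
    fermat zero    = subst (λ m → 0# ^ m ≈ 0#) (ℕ.suc-pred p) (zeroˡ _)
    fermat (suc n) = begin
      (1# + n ×′ 1#) ^ p          ≈⟨ freshman's-dream 1# (n ×′ 1#) ⟩
      1# ^ p + (n ×′ 1#) ^ p      ≈⟨ +-cong (1#^n≈1# semiring p) (fermat n) ⟩
      1# + n ×′ 1#                ∎

parity : ∀ n → (∃ λ e → n ≡ e ℕ.+ e) ⊎ (∃ λ e → n ≡ suc (e ℕ.+ e))
parity zero    = inj₁ (0 , refl)
parity (suc n) with parity n
... | inj₁ (e , n≡e+e)   = inj₂ (e , cong suc n≡e+e)
... | inj₂ (e , n≡1+e+e) = inj₁ (suc e , cong suc (trans n≡1+e+e (sym (ℕ.+-suc e e))))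

module Residues (p : ℕ) .{{_ : NonZero p}} where
  open ≡-Reasoning

  infixl 6 _+ₚ_
  infixl 7 _*ₚ_
  infix 8 -ₚ_

  [_] : ℕ → Fin p
  [ k ] = k mod p

  _+ₚ_ _*ₚ_ : Fin p → Fin p → Fin p
  a +ₚ b = [ toℕ a ℕ.+ toℕ b ]
  a *ₚ b = [ toℕ a ℕ.* toℕ b ]

  -ₚ_ : Fin p → Fin p
  -ₚ a = [ p ℕ.∸ toℕ a ]

  0ₚ 1ₚ : Fin p
  0ₚ = [ 0 ]
  1ₚ = [ 1 ]

  toℕ-[] : ∀ k → toℕ [ k ] ≡ k % p
  toℕ-[] k = toℕ-fromℕ< _

  []-toℕ : ∀ a → [ toℕ a ] ≡ a
  []-toℕ a = toℕ-injective (trans (toℕ-[] (toℕ a)) (m<n⇒m%n≡m (toℕ<n a)))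

  []-+ : ∀ m n → [ m ℕ.+ n ] ≡ [ m ] +ₚ [ n ]
  []-+ m n = toℕ-injective (begin
    toℕ [ m ℕ.+ n ]                    ≡⟨ toℕ-[] _ ⟩
    (m ℕ.+ n) % p                      ≡⟨ %-distribˡ-+ m n p ⟩
    (m % p ℕ.+ n % p) % p              ≡⟨ cong₂ (λ s t → (s ℕ.+ t) % p) (toℕ-[] m) (toℕ-[] n) ⟨
    (toℕ [ m ] ℕ.+ toℕ [ n ]) % p      ≡⟨ toℕ-[] _ ⟨
    toℕ ([ m ] +ₚ [ n ])               ∎)

  []-* : ∀ m n → [ m ℕ.* n ] ≡ [ m ] *ₚ [ n ]
  []-* m n = toℕ-injective (begin
    toℕ [ m ℕ.* n ]                    ≡⟨ toℕ-[] _ ⟩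
    (m ℕ.* n) % p                      ≡⟨ %-distribˡ-* m n p ⟩
    (m % p ℕ.* (n % p)) % p            ≡⟨ cong₂ (λ s t → (s ℕ.* t) % p) (toℕ-[] m) (toℕ-[] n) ⟨
    (toℕ [ m ] ℕ.* toℕ [ n ]) % p      ≡⟨ toℕ-[] _ ⟨
    toℕ ([ m ] *ₚ [ n ])               ∎)

  toℕ-0ₚ : toℕ 0ₚ ≡ 0
  toℕ-0ₚ = trans (toℕ-[] 0) (m<n⇒m%n≡m (ℕ.>-nonZero⁻¹ p))

  ∣⇒[]≡0ₚ : ∀ {n} → p ∣ n → [ n ] ≡ 0ₚ
  ∣⇒[]≡0ₚ {n} p∣n = toℕ-injective (trans (toℕ-[] n) (trans (n∣m⇒m%n≡0 n p p∣n) (sym toℕ-0ₚ)))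

  []≡0ₚ⇒∣ : ∀ {n} → [ n ] ≡ 0ₚ → p ∣ n
  []≡0ₚ⇒∣ {n} [n]≡0 = m%n≡0⇒n∣m n p (trans (sym (toℕ-[] n)) (trans (cong toℕ [n]≡0) toℕ-0ₚ))

  [p]≡0ₚ : [ p ] ≡ 0ₚ
  [p]≡0ₚ = ∣⇒[]≡0ₚ ∣-refl

  +ₚ-assoc : ∀ a b c → (a +ₚ b) +ₚ c ≡ a +ₚ (b +ₚ c)
  +ₚ-assoc a b c = begin
    (a +ₚ b) +ₚ c                      ≡⟨ cong ((a +ₚ b) +ₚ_) ([]-toℕ c) ⟨
    [ toℕ a ℕ.+ toℕ b ] +ₚ [ toℕ c ]   ≡⟨ []-+ _ _ ⟨
    [ toℕ a ℕ.+ toℕ b ℕ.+ toℕ c ]      ≡⟨ cong [_] (ℕ.+-assoc (toℕ a) _ _) ⟩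
    [ toℕ a ℕ.+ (toℕ b ℕ.+ toℕ c) ]    ≡⟨ []-+ _ _ ⟩
    [ toℕ a ] +ₚ (b +ₚ c)              ≡⟨ cong (_+ₚ (b +ₚ c)) ([]-toℕ a) ⟩
    a +ₚ (b +ₚ c)                      ∎

  *ₚ-assoc : ∀ a b c → (a *ₚ b) *ₚ c ≡ a *ₚ (b *ₚ c)
  *ₚ-assoc a b c = begin
    (a *ₚ b) *ₚ c                      ≡⟨ cong ((a *ₚ b) *ₚ_) ([]-toℕ c) ⟨
    [ toℕ a ℕ.* toℕ b ] *ₚ [ toℕ c ]   ≡⟨ []-* _ _ ⟨
    [ toℕ a ℕ.* toℕ b ℕ.* toℕ c ]      ≡⟨ cong [_] (ℕ.*-assoc (toℕ a) _ _) ⟩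
    [ toℕ a ℕ.* (toℕ b ℕ.* toℕ c) ]    ≡⟨ []-* _ _ ⟩
    [ toℕ a ] *ₚ (b *ₚ c)              ≡⟨ cong (_*ₚ (b *ₚ c)) ([]-toℕ a) ⟩
    a *ₚ (b *ₚ c)                      ∎

  *ₚ-distribˡ-+ₚ : ∀ a b c → a *ₚ (b +ₚ c) ≡ a *ₚ b +ₚ a *ₚ c
  *ₚ-distribˡ-+ₚ a b c = begin
    a *ₚ (b +ₚ c)                          ≡⟨ cong (_*ₚ (b +ₚ c)) ([]-toℕ a) ⟨
    [ toℕ a ] *ₚ [ toℕ b ℕ.+ toℕ c ]       ≡⟨ []-* _ _ ⟨
    [ toℕ a ℕ.* (toℕ b ℕ.+ toℕ c) ]        ≡⟨ cong [_] (ℕ.*-distribˡ-+ (toℕ a) (toℕ b) _) ⟩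
    [ toℕ a ℕ.* toℕ b ℕ.+ toℕ a ℕ.* toℕ c ] ≡⟨ []-+ _ _ ⟩
    a *ₚ b +ₚ a *ₚ c                       ∎

  +ₚ-identityˡ : ∀ a → 0ₚ +ₚ a ≡ a
  +ₚ-identityˡ a = begin
    0ₚ +ₚ a            ≡⟨ cong (0ₚ +ₚ_) ([]-toℕ a) ⟨
    [ 0 ] +ₚ [ toℕ a ] ≡⟨ []-+ 0 (toℕ a) ⟨
    [ toℕ a ]          ≡⟨ []-toℕ a ⟩
    a                  ∎

  *ₚ-identityˡ : ∀ a → 1ₚ *ₚ a ≡ a
  *ₚ-identityˡ a = begin
    1ₚ *ₚ a                ≡⟨ cong (1ₚ *ₚ_) ([]-toℕ a) ⟨
    [ 1 ] *ₚ [ toℕ a ]     ≡⟨ []-* 1 (toℕ a) ⟨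
    [ 1 ℕ.* toℕ a ]        ≡⟨ cong [_] (ℕ.*-identityˡ (toℕ a)) ⟩
    [ toℕ a ]              ≡⟨ []-toℕ a ⟩
    a                      ∎

  -ₚ‿inverseˡ : ∀ a → -ₚ a +ₚ a ≡ 0ₚ
  -ₚ‿inverseˡ a = begin
    -ₚ a +ₚ a                       ≡⟨ cong (-ₚ a +ₚ_) ([]-toℕ a) ⟨
    [ p ℕ.∸ toℕ a ] +ₚ [ toℕ a ]    ≡⟨ []-+ _ _ ⟨
    [ p ℕ.∸ toℕ a ℕ.+ toℕ a ]       ≡⟨ cong [_] (ℕ.m∸n+n≡m (ℕ.<⇒≤ (toℕ<n a))) ⟩
    [ p ]                           ≡⟨ [p]≡0ₚ ⟩
    0ₚ                              ∎

  Fp-ring : CommutativeRing 0ℓ 0ℓ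
  Fp-ring = mkCommutativeRing _+ₚ_ _*ₚ_ -ₚ_ 0ₚ 1ₚ
    +ₚ-assoc (λ a b → cong [_] (ℕ.+-comm (toℕ a) _)) +ₚ-identityˡ -ₚ‿inverseˡ
    *ₚ-assoc (λ a b → cong [_] (ℕ.*-comm (toℕ a) _)) *ₚ-identityˡ *ₚ-distribˡ-+ₚ

  module Fp = CommutativeRing Fp-ring
  module Fp-Solver = IntegerCoefficients Fp-ring

  open import Algebra.Properties.Ring Fp.ring public
    using () renaming (-0#≈0# to -ₚ0ₚ≡0ₚ; -‿involutive to -ₚ-involutive; x[y-z]≈xy-xz to *ₚ-distribˡ-;
                       x∙y⁻¹≈ε⇒x≈y to x-y≡0ₚ⇒x≡y; x≈y⇒x∙y⁻¹≈ε to x≡y⇒x-y≡0ₚ)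

  open import Algebra.Properties.CommutativeSemiring.Exp Fp.commutativeSemiring public
    using () renaming (_^_ to _^ₚ_; ^-distrib-* to ^ₚ-distrib-*ₚ; ^-homo-* to ^ₚ-homo-+)

  module PrimeModulus (p-prime : Prime p) where

    1ₚ≢0ₚ : 1ₚ ≢ 0ₚ
    1ₚ≢0ₚ 1≡0 = ℕ.<-irrefl refl (subst (1 ℕ.<_) (∣1⇒≡1 ([]≡0ₚ⇒∣ 1≡0)) (ℕ.nonTrivial⇒n>1 p))
      where instance _ = prime⇒nonTrivial p-prime

    *ₚ-integral : ∀ a b → a *ₚ b ≡ 0ₚ → a ≡ 0ₚ ⊎ b ≡ 0ₚ
    *ₚ-integral a b ab≡0 with euclidsLemma (toℕ a) (toℕ b) p-prime ([]≡0ₚ⇒∣ ab≡0)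
    ... | inj₁ p∣a = inj₁ (trans (sym ([]-toℕ a)) (∣⇒[]≡0ₚ p∣a))
    ... | inj₂ p∣b = inj₂ (trans (sym ([]-toℕ b)) (∣⇒[]≡0ₚ p∣b))

    *ₚ-cancelˡ : ∀ {a x y} → a ≢ 0ₚ → a *ₚ x ≡ a *ₚ y → x ≡ y
    *ₚ-cancelˡ {a} {x} {y} a≢0 ax≡ay with *ₚ-integral a (x +ₚ -ₚ y)
      (trans (*ₚ-distribˡ- a x y) (x≡y⇒x-y≡0ₚ ax≡ay))
    ... | inj₁ a≡0   = ⊥-elim (a≢0 a≡0)
    ... | inj₂ x-y≡0 = x-y≡0ₚ⇒x≡y x y x-y≡0

    *ₚ-inverse : ∀ {a} → a ≢ 0ₚ → ∃ λ b → a *ₚ b ≡ 1ₚ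
    *ₚ-inverse a≢0 = Fin-injective⇒surjective _ (*ₚ-cancelˡ a≢0) 1ₚ

    ^ₚ-nonzero : ∀ {a} n → a ≢ 0ₚ → a ^ₚ n ≢ 0ₚ
    ^ₚ-nonzero zero    a≢0 = 1ₚ≢0ₚ
    ^ₚ-nonzero (suc n) a≢0 aⁿ⁺¹≡0 with *ₚ-integral _ _ aⁿ⁺¹≡0
    ... | inj₁ a≡0  = a≢0 a≡0
    ... | inj₂ aⁿ≡0 = ^ₚ-nonzero n a≢0 aⁿ≡0

    +ₚ-double≡0 : p ≢ 2 → ∀ a → a +ₚ a ≡ 0ₚ → a ≡ 0ₚ
    +ₚ-double≡0 p≢2 a a+a≡0
      with euclidsLemma 2 (toℕ a) p-prime
             (subst (p ∣_) (cong (toℕ a ℕ.+_) (sym (ℕ.+-identityʳ (toℕ a)))) ([]≡0ₚ⇒∣ a+a≡0))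
    ... | inj₁ p∣2 = ⊥-elim (p≢2 (ℕ.≤-antisym (∣⇒≤ p∣2) (ℕ.nonTrivial⇒n>1 p)))
      where instance _ = prime⇒nonTrivial p-prime
    ... | inj₂ p∣a = trans (sym ([]-toℕ a)) (∣⇒[]≡0ₚ p∣a)

    ≡-ₚ⇒≡0ₚ : p ≢ 2 → ∀ {a} → a ≡ -ₚ a → a ≡ 0ₚ
    ≡-ₚ⇒≡0ₚ p≢2 {a} a≡-a = +ₚ-double≡0 p≢2 a (trans (cong (_+ₚ a) a≡-a) (-ₚ‿inverseˡ a))

module QuadraticExtension (p : ℕ) .{{_ : NonZero p}} (w : ℕ) where
  open FF p w hiding (Fp)
  open Residues p
  open ≡-Reasoning

  wₚ : Fin p
  wₚ = [ w ]

  -- Defs.FF adds and negates componentwise through [_], so _+_ and -_ are already the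
  -- componentwise residue operations; only its product, reduced from raw naturals, needs _⊛_.
  infixl 7 _⊛_
  _⊛_ : F → F → F
  (a , b) ⊛ (c , d) = (a *ₚ c +ₚ wₚ *ₚ (b *ₚ d) , a *ₚ d +ₚ b *ₚ c)

  *≡⊛ : ∀ x y → x * y ≡ x ⊛ y
  *≡⊛ (a , b) (c , d) = cong₂ _,_
    (trans ([]-+ _ _) (cong (a *ₚ c +ₚ_) ([]-* w _)))
    ([]-+ _ _)

  *-assoc : ∀ x y z → (x * y) * z ≡ x * (y * z)
  *-assoc x@(a , b) y@(c , d) z@(e , g) = begin
    (x * y) * z   ≡⟨ cong (_* z) (*≡⊛ x y) ⟩
    (x ⊛ y) * z   ≡⟨ *≡⊛ (x ⊛ y) z ⟩
    (x ⊛ y) ⊛ z   ≡⟨ cong₂ _,_ (assoc₁ a b c d e g wₚ) (assoc₂ a b c d e g wₚ) ⟩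
    x ⊛ (y ⊛ z)   ≡⟨ *≡⊛ x (y ⊛ z) ⟨
    x * (y ⊛ z)   ≡⟨ cong (x *_) (*≡⊛ y z) ⟨
    x * (y * z)   ∎
    where
    open Fp-Solver
    assoc₁ : ∀ a b c d e g w → (a *ₚ c +ₚ w *ₚ (b *ₚ d)) *ₚ e +ₚ w *ₚ ((a *ₚ d +ₚ b *ₚ c) *ₚ g)
                             ≡ a *ₚ (c *ₚ e +ₚ w *ₚ (d *ₚ g)) +ₚ w *ₚ (b *ₚ (c *ₚ g +ₚ d *ₚ e))
    assoc₁ = solve 7 (λ a b c d e g w →
      (a :* c :+ w :* (b :* d)) :* e :+ w :* ((a :* d :+ b :* c) :* g)
        := a :* (c :* e :+ w :* (d :* g)) :+ w :* (b :* (c :* g :+ d :* e))) refl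
    assoc₂ : ∀ a b c d e g w → (a *ₚ c +ₚ w *ₚ (b *ₚ d)) *ₚ g +ₚ (a *ₚ d +ₚ b *ₚ c) *ₚ e
                             ≡ a *ₚ (c *ₚ g +ₚ d *ₚ e) +ₚ b *ₚ (c *ₚ e +ₚ w *ₚ (d *ₚ g))
    assoc₂ = solve 7 (λ a b c d e g w →
      (a :* c :+ w :* (b :* d)) :* g :+ (a :* d :+ b :* c) :* e
        := a :* (c :* g :+ d :* e) :+ b :* (c :* e :+ w :* (d :* g))) refl

  *-comm : ∀ x y → x * y ≡ y * x
  *-comm x@(a , b) y@(c , d) = begin
    x * y  ≡⟨ *≡⊛ x y ⟩
    x ⊛ y  ≡⟨ cong₂ _,_ (comm₁ a b c d wₚ) (comm₂ a b c d) ⟩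
    y ⊛ x  ≡⟨ *≡⊛ y x ⟨
    y * x  ∎
    where
    open Fp-Solver
    comm₁ : ∀ a b c d w → a *ₚ c +ₚ w *ₚ (b *ₚ d) ≡ c *ₚ a +ₚ w *ₚ (d *ₚ b)
    comm₁ = solve 5 (λ a b c d w → a :* c :+ w :* (b :* d) := c :* a :+ w :* (d :* b)) refl
    comm₂ : ∀ a b c d → a *ₚ d +ₚ b *ₚ c ≡ c *ₚ b +ₚ d *ₚ a
    comm₂ = solve 4 (λ a b c d → a :* d :+ b :* c := c :* b :+ d :* a) refl

  *-identityˡ : ∀ x → 1F * x ≡ x
  *-identityˡ x@(a , b) = trans (*≡⊛ 1F x) (cong₂ _,_ (id₁ a b wₚ) (id₂ a b))
    where
    open Fp-Solver
    id₁ : ∀ a b w → 1ₚ *ₚ a +ₚ w *ₚ (0ₚ *ₚ b) ≡ a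
    id₁ = solve 3 (λ a b w → con 1ℤ :* a :+ w :* (con 0ℤ :* b) := a) refl
    id₂ : ∀ a b → 1ₚ *ₚ b +ₚ 0ₚ *ₚ a ≡ b
    id₂ = solve 2 (λ a b → con 1ℤ :* b :+ con 0ℤ :* a := b) refl

  distribˡ : ∀ x y z → x * (y + z) ≡ x * y + x * z
  distribˡ x@(a , b) y@(c , d) z@(e , g) = begin
    x * (y + z)          ≡⟨ *≡⊛ x (y + z) ⟩
    x ⊛ (y + z)          ≡⟨ cong₂ _,_ (distrib₁ a b c d e g wₚ) (distrib₂ a b c d e g) ⟩
    x ⊛ y + x ⊛ z        ≡⟨ cong₂ _+_ (*≡⊛ x y) (*≡⊛ x z) ⟨
    x * y + x * z        ∎
    where
    open Fp-Solver
    distrib₁ : ∀ a b c d e g w → a *ₚ (c +ₚ e) +ₚ w *ₚ (b *ₚ (d +ₚ g))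
                               ≡ (a *ₚ c +ₚ w *ₚ (b *ₚ d)) +ₚ (a *ₚ e +ₚ w *ₚ (b *ₚ g))
    distrib₁ = solve 7 (λ a b c d e g w →
      a :* (c :+ e) :+ w :* (b :* (d :+ g)) := (a :* c :+ w :* (b :* d)) :+ (a :* e :+ w :* (b :* g))) refl
    distrib₂ : ∀ a b c d e g → a *ₚ (d +ₚ g) +ₚ b *ₚ (c +ₚ e) ≡ (a *ₚ d +ₚ b *ₚ c) +ₚ (a *ₚ g +ₚ b *ₚ e)
    distrib₂ = solve 6 (λ a b c d e g →
      a :* (d :+ g) :+ b :* (c :+ e) := (a :* d :+ b :* c) :+ (a :* g :+ b :* e)) refl

  F-ring : CommutativeRing 0ℓ 0ℓ
  F-ring = mkCommutativeRing _+_ _*_ -_ 0F 1F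
    (λ (a , b) (c , d) (e , g) → cong₂ _,_ (Fp.+-assoc a c e) (Fp.+-assoc b d g))
    (λ (a , b) (c , d) → cong₂ _,_ (Fp.+-comm a c) (Fp.+-comm b d))
    (λ (a , b) → cong₂ _,_ (Fp.+-identityˡ a) (Fp.+-identityˡ b))
    (λ (a , b) → cong₂ _,_ (Fp.-‿inverseˡ a) (Fp.-‿inverseˡ b))
    *-assoc *-comm *-identityˡ distribˡ

  module F = CommutativeRing F-ring
  module F-Solver = IntegerCoefficients F-ring
  open import Algebra.Properties.Ring F.ring public using (-‿distribˡ-*; -‿distribʳ-*; -‿involutive)
    renaming (x≈y⇒x∙y⁻¹≈ε to x≡y⇒x-y≡0F; x∙y⁻¹≈ε⇒x≈y to x-y≡0F⇒x≡y; +-inverseˡ-unique to x+y≡0F⇒x≡-y;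
              -1*x≈-x to -1*x≡-x; -0#≈0# to -0F≡0F)

  ι-scale : ∀ a x y → ι a * (x , y) ≡ (a *ₚ x , a *ₚ y)
  ι-scale a x y = trans (*≡⊛ (ι a) (x , y)) (cong₂ _,_ (scale₁ a x y wₚ) (scale₂ a x y))
    where
    open Fp-Solver
    scale₁ : ∀ a x y w → a *ₚ x +ₚ w *ₚ (0ₚ *ₚ y) ≡ a *ₚ x
    scale₁ = solve 4 (λ a x y w → a :* x :+ w :* (con 0ℤ :* y) := a :* x) refl
    scale₂ : ∀ a x y → a *ₚ y +ₚ 0ₚ *ₚ x ≡ a *ₚ y
    scale₂ = solve 3 (λ a x y → a :* y :+ con 0ℤ :* x := a :* y) refl

  ι-+ : ∀ a b → ι (a +ₚ b) ≡ ι a + ι b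
  ι-+ a b = cong (a +ₚ b ,_) (sym (Fp.+-identityˡ 0ₚ))

  ι-* : ∀ a b → ι (a *ₚ b) ≡ ι a * ι b
  ι-* a b = sym (trans (ι-scale a b 0ₚ) (cong (a *ₚ b ,_) (Fp.zeroʳ a)))

  ι-neg : ∀ a → ι (-ₚ a) ≡ - ι a
  ι-neg a = cong (-ₚ a ,_) (sym -ₚ0ₚ≡0ₚ)

  ι-injective : ∀ {a b} → ι a ≡ ι b → a ≡ b
  ι-injective = ,-injectiveˡ

  ω : F
  ω = (0ₚ , 1ₚ)

  ω*ω : ω * ω ≡ ι wₚ
  ω*ω = trans (*≡⊛ ω ω) (cong₂ _,_ (square₁ wₚ) square₂)
    where
    open Fp-Solver
    square₁ : ∀ w → 0ₚ *ₚ 0ₚ +ₚ w *ₚ (1ₚ *ₚ 1ₚ) ≡ w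
    square₁ = solve 1 (λ w → con 0ℤ :* con 0ℤ :+ w :* (con 1ℤ :* con 1ℤ) := w) refl
    square₂ : 0ₚ *ₚ 1ₚ +ₚ 1ₚ *ₚ 0ₚ ≡ 0ₚ
    square₂ = solve 0 (con 0ℤ :* con 1ℤ :+ con 1ℤ :* con 0ℤ := con 0ℤ) refl

  ι*ω : ∀ b → ι b * ω ≡ (0ₚ , b)
  ι*ω b = trans (ι-scale b 0ₚ 1ₚ) (cong₂ _,_ (Fp.zeroʳ b) (Fp.*-identityʳ b))

  ι+ι*ω : ∀ a b → ι a + ι b * ω ≡ (a , b)
  ι+ι*ω a b = trans (cong (ι a +_) (ι*ω b)) (cong₂ _,_ (Fp.+-identityʳ a) (Fp.+-identityˡ b))

  OnLine : F → F → Set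
  OnLine z x = ∃ λ k → x ≡ ι k * z

  ι-+-line : ∀ l m z → ι l * z + ι m * z ≡ ι (l +ₚ m) * z
  ι-+-line l m z = trans (sym (F.distribʳ z (ι l) (ι m))) (cong (_* z) (sym (ι-+ l m)))

  ι-*-line : ∀ l m z → ι l * (ι m * z) ≡ ι (l *ₚ m) * z
  ι-*-line l m z = trans (sym (F.*-assoc (ι l) (ι m) z)) (cong (_* z) (sym (ι-* l m)))

  unshift-line : ∀ {z x} l → OnLine z (x + ι l * z) → OnLine z x
  unshift-line {z} {x} l (k , x+lz≡kz) = k +ₚ -ₚ l , (begin
    x                          ≡⟨ add-subtract x (ι l * z) ⟩
    x + ι l * z - ι l * z      ≡⟨ cong (_- ι l * z) x+lz≡kz ⟩
    ι k * z - ι l * z          ≡⟨ cong (ι k * z +_) (-‿distribˡ-* (ι l) z) ⟩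
    ι k * z + - ι l * z        ≡⟨ cong (λ t → ι k * z + t * z) (ι-neg l) ⟨
    ι k * z + ι (-ₚ l) * z     ≡⟨ ι-+-line k (-ₚ l) z ⟩
    ι (k +ₚ -ₚ l) * z          ∎)
    where
    add-subtract : ∀ x y → x ≡ x + y - y
    add-subtract = solve 2 (λ x y → x := x :+ y :- y) refl
      where open F-Solver

  conj : F → F
  conj (a , b) = (a , -ₚ b)

  norm : F → Fin p
  norm (a , b) = a *ₚ a +ₚ -ₚ (wₚ *ₚ (b *ₚ b))

  *-conj : ∀ u → u * conj u ≡ ι (norm u)
  *-conj (a , b) = trans (*≡⊛ (a , b) (a , -ₚ b)) (cong₂ _,_ (conj₁ a b wₚ) (conj₂ a b))
    where
    open Fp-Solver
    conj₁ : ∀ a b w → a *ₚ a +ₚ w *ₚ (b *ₚ -ₚ b) ≡ a *ₚ a +ₚ -ₚ (w *ₚ (b *ₚ b))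
    conj₁ = solve 3 (λ a b w → a :* a :+ w :* (b :* (:- b)) := a :* a :- w :* (b :* b)) refl
    conj₂ : ∀ a b → a *ₚ -ₚ b +ₚ b *ₚ a ≡ 0ₚ
    conj₂ = solve 2 (λ a b → a :* (:- b) :+ b :* a := con 0ℤ) refl

  module Field (p-prime : Prime p) (w-nonsquare : NonSquareW) where
    open Residues.PrimeModulus p p-prime

    nonsquare-ratio : ∀ s {t} → t ≢ 0ₚ → s *ₚ s ≢ wₚ *ₚ (t *ₚ t)
    nonsquare-ratio s {t} t≢0 ss≡wtt = w-nonsquare (s *ₚ t′) (begin
      (s *ₚ t′) *ₚ (s *ₚ t′)               ≡⟨ regroup s t′ ⟩
      (s *ₚ s) *ₚ (t′ *ₚ t′)               ≡⟨ cong (_*ₚ (t′ *ₚ t′)) ss≡wtt ⟩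
      (wₚ *ₚ (t *ₚ t)) *ₚ (t′ *ₚ t′)       ≡⟨ regroup′ wₚ t t′ ⟩
      wₚ *ₚ ((t *ₚ t′) *ₚ (t *ₚ t′))       ≡⟨ cong (λ u → wₚ *ₚ (u *ₚ u)) tt′≡1 ⟩
      wₚ *ₚ (1ₚ *ₚ 1ₚ)                     ≡⟨ cong (wₚ *ₚ_) (Fp.*-identityˡ 1ₚ) ⟩
      wₚ *ₚ 1ₚ                             ≡⟨ Fp.*-identityʳ wₚ ⟩
      wₚ                                   ∎)
      where
      open Fp-Solver
      t′ : Fin p
      t′ = proj₁ (*ₚ-inverse t≢0)
      tt′≡1 : t *ₚ t′ ≡ 1ₚ
      tt′≡1 = proj₂ (*ₚ-inverse t≢0)
      regroup : ∀ a c → (a *ₚ c) *ₚ (a *ₚ c) ≡ (a *ₚ a) *ₚ (c *ₚ c)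
      regroup = solve 2 (λ a c → (a :* c) :* (a :* c) := (a :* a) :* (c :* c)) refl
      regroup′ : ∀ w b c → (w *ₚ (b *ₚ b)) *ₚ (c *ₚ c) ≡ w *ₚ ((b *ₚ c) *ₚ (b *ₚ c))
      regroup′ = solve 3 (λ w b c → (w :* (b :* b)) :* (c :* c) := w :* ((b :* c) :* (b :* c))) refl

    norm≡0 : ∀ u → norm u ≡ 0ₚ → u ≡ 0F
    norm≡0 (a , b) N≡0 with b ≟ 0ₚ
    ... | yes refl = cong (_, 0ₚ) (reduce (*ₚ-integral a a (trans (drop-b a wₚ) N≡0)))
      where
      open Fp-Solver
      drop-b : ∀ a w → a *ₚ a ≡ a *ₚ a +ₚ -ₚ (w *ₚ (0ₚ *ₚ 0ₚ))
      drop-b = solve 2 (λ a w → a :* a := a :* a :- w :* (con 0ℤ :* con 0ℤ)) refl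
    ... | no b≢0 = ⊥-elim (nonsquare-ratio a b≢0 (x-y≡0ₚ⇒x≡y (a *ₚ a) (wₚ *ₚ (b *ₚ b)) N≡0))

    1F≢0F : 1F ≢ 0F
    1F≢0F 1≡0 = 1ₚ≢0ₚ (,-injectiveˡ 1≡0)

    ω≢0 : ω ≢ 0F
    ω≢0 ω≡0 = 1ₚ≢0ₚ (,-injectiveʳ ω≡0)

    *-inverseˡ : ∀ {u} → u ≢ 0F → ∃ λ v → v * u ≡ 1F
    *-inverseˡ {u} u≢0 = ι N′ * conj u , (begin
      (ι N′ * conj u) * u   ≡⟨ regroup (ι N′) (conj u) u ⟩
      ι N′ * (u * conj u)   ≡⟨ cong (ι N′ *_) (*-conj u) ⟩
      ι N′ * ι (norm u)     ≡⟨ ι-* N′ (norm u) ⟨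
      ι (N′ *ₚ norm u)      ≡⟨ cong ι (trans (Fp.*-comm N′ (norm u)) NN′≡1) ⟩
      1F                    ∎)
      where
      open F-Solver
      regroup : ∀ a c u → (a * c) * u ≡ a * (u * c)
      regroup = solve 3 (λ a c u → (a :* c) :* u := a :* (u :* c)) refl
      N≢0 : norm u ≢ 0ₚ
      N≢0 N≡0 = u≢0 (norm≡0 u N≡0)
      N′ : Fin p
      N′ = proj₁ (*ₚ-inverse N≢0)
      NN′≡1 : norm u *ₚ N′ ≡ 1ₚ
      NN′≡1 = proj₂ (*ₚ-inverse N≢0)

    *-cancelˡ : ∀ {a x y} → a ≢ 0F → a * x ≡ a * y → x ≡ y
    *-cancelˡ {a} {x} {y} a≢0 ax≡ay = begin
      x              ≡⟨ F.*-identityˡ x ⟨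
      1F * x         ≡⟨ cong (_* x) a′a≡1 ⟨
      (a′ * a) * x   ≡⟨ F.*-assoc a′ a x ⟩
      a′ * (a * x)   ≡⟨ cong (a′ *_) ax≡ay ⟩
      a′ * (a * y)   ≡⟨ F.*-assoc a′ a y ⟨
      (a′ * a) * y   ≡⟨ cong (_* y) a′a≡1 ⟩
      1F * y         ≡⟨ F.*-identityˡ y ⟩
      y              ∎
      where
      a′ : F
      a′ = proj₁ (*-inverseˡ a≢0)
      a′a≡1 : a′ * a ≡ 1F
      a′a≡1 = proj₂ (*-inverseˡ a≢0)

    *-integral : ∀ u v → u * v ≡ 0F → u ≡ 0F ⊎ v ≡ 0F
    *-integral u v uv≡0 with u ≟F 0F
    ... | yes u≡0 = inj₁ u≡0
    ... | no  u≢0 = inj₂ (*-cancelˡ u≢0 (trans uv≡0 (sym (F.zeroʳ u))))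

    *-nonzero : ∀ {u v} → u ≢ 0F → v ≢ 0F → u * v ≢ 0F
    *-nonzero u≢0 v≢0 uv≡0 with *-integral _ _ uv≡0
    ... | inj₁ u≡0 = u≢0 u≡0
    ... | inj₂ v≡0 = v≢0 v≡0

    ι*-injectiveʳ : ∀ {z} → z ≢ 0F → ∀ {l l′} → ι l * z ≡ ι l′ * z → l ≡ l′
    ι*-injectiveʳ z≢0 {l} {l′} e = ι-injective (*-cancelˡ z≢0 (trans (F.*-comm _ (ι l)) (trans e (F.*-comm (ι l′) _))))

    ω+ι-off-line : ∀ {z} → z ≢ 0F → ∀ c → ¬ OnLine z ((ω + ι c) * z)
    ω+ι-off-line {z} z≢0 c (k , e) = 1ₚ≢0ₚ (trans (sym (Fp.+-identityʳ 1ₚ)) (,-injectiveʳ (*-cancelˡ z≢0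
      (trans (F.*-comm z (ω + ι c)) (trans e (F.*-comm (ι k) z))))))

    scale-line : ∀ {z y} k → OnLine z y → OnLine z (ι k * y)
    scale-line {z} {y} k (l , y≡lz) = k *ₚ l , trans (cong (ι k *_) y≡lz) (ι-*-line k l z)

    unscale-line : ∀ {z y k} → k ≢ 0ₚ → OnLine z (ι k * y) → OnLine z y
    unscale-line {z} {y} {k} k≢0 (l , ky≡lz) = k′ *ₚ l , (begin
      y                     ≡⟨ F.*-identityˡ y ⟨
      1F * y                ≡⟨ cong (λ t → ι t * y) k′k≡1 ⟨
      ι (k′ *ₚ k) * y       ≡⟨ ι-*-line k′ k y ⟨
      ι k′ * (ι k * y)      ≡⟨ cong (ι k′ *_) ky≡lz ⟩
      ι k′ * (ι l * z)      ≡⟨ ι-*-line k′ l z ⟩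
      ι (k′ *ₚ l) * z       ∎)
      where
      k′ : Fin p
      k′ = proj₁ (*ₚ-inverse k≢0)
      k′k≡1 : k′ *ₚ k ≡ 1ₚ
      k′k≡1 = trans (Fp.*-comm k′ k) (proj₂ (*ₚ-inverse k≢0))

    ι-basis : ∀ {r} → proj₂ r ≢ 0ₚ → ∀ q → ∃ λ α → ∃ λ γ → q ≡ ι α + ι γ * r
    ι-basis {r₁ , r₂} r₂≢0 (q₁ , q₂) = α , γ , sym (begin
      ι α + ι γ * (r₁ , r₂)          ≡⟨ cong (ι α +_) (ι-scale γ r₁ r₂) ⟩
      (α +ₚ γ *ₚ r₁ , 0ₚ +ₚ γ *ₚ r₂)  ≡⟨ cong₂ _,_ (subtract-add q₁ (γ *ₚ r₁)) (Fp.+-identityˡ (γ *ₚ r₂)) ⟩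
      (q₁ , γ *ₚ r₂)                 ≡⟨ cong (q₁ ,_) γr₂≡q₂ ⟩
      (q₁ , q₂)                      ∎)
      where
      r₂′ : Fin p
      r₂′ = proj₁ (*ₚ-inverse r₂≢0)
      γ α : Fin p
      γ = q₂ *ₚ r₂′
      α = q₁ +ₚ -ₚ (γ *ₚ r₁)
      γr₂≡q₂ : γ *ₚ r₂ ≡ q₂
      γr₂≡q₂ = trans (Fp.*-assoc q₂ r₂′ r₂)
        (trans (cong (q₂ *ₚ_) (trans (Fp.*-comm r₂′ r₂) (proj₂ (*ₚ-inverse r₂≢0)))) (Fp.*-identityʳ q₂))
      subtract-add : ∀ q g → q +ₚ -ₚ g +ₚ g ≡ q
      subtract-add = solve 2 (λ q g → q :- g :+ g := q) refl
        where open Fp-Solver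

    basis : ∀ {z₁ z₂} → z₁ ≢ 0F → ¬ OnLine z₁ z₂ → ∀ z → ∃ λ α → ∃ λ γ → z ≡ ι α * z₁ + ι γ * z₂
    basis {z₁} {z₂} z₁≢0 z₂-off-line z = α , γ , (begin
      z                            ≡⟨ divide-multiply z ⟨
      z * z₁′ * z₁                 ≡⟨ cong (_* z₁) z/z₁≡α+γr ⟩
      (ι α + ι γ * r) * z₁         ≡⟨ F.distribʳ z₁ (ι α) (ι γ * r) ⟩
      ι α * z₁ + ι γ * r * z₁      ≡⟨ cong (ι α * z₁ +_) (F.*-assoc (ι γ) r z₁) ⟩
      ι α * z₁ + ι γ * (r * z₁)    ≡⟨ cong (λ t → ι α * z₁ + ι γ * t) (divide-multiply z₂) ⟩
      ι α * z₁ + ι γ * z₂          ∎)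
      where
      z₁′ : F
      z₁′ = proj₁ (*-inverseˡ z₁≢0)
      divide-multiply : ∀ y → y * z₁′ * z₁ ≡ y
      divide-multiply y = trans (F.*-assoc y z₁′ z₁) (trans (cong (y *_) (proj₂ (*-inverseˡ z₁≢0))) (F.*-identityʳ y))
      r : F
      r = z₂ * z₁′
      im[r]≢0 : proj₂ r ≢ 0ₚ
      im[r]≢0 im[r]≡0 = z₂-off-line (proj₁ r , (begin
        z₂                          ≡⟨ divide-multiply z₂ ⟨
        (proj₁ r , proj₂ r) * z₁    ≡⟨ cong (λ t → (proj₁ r , t) * z₁) im[r]≡0 ⟩
        ι (proj₁ r) * z₁            ∎))
      α γ : Fin p
      α = proj₁ (ι-basis {r} im[r]≢0 (z * z₁′))
      γ = proj₁ (proj₂ (ι-basis {r} im[r]≢0 (z * z₁′)))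
      z/z₁≡α+γr : z * z₁′ ≡ ι α + ι γ * r
      z/z₁≡α+γr = proj₂ (proj₂ (ι-basis {r} im[r]≢0 (z * z₁′)))

    open import Algebra.Properties.CommutativeSemiring.Exp F.commutativeSemiring
      using () renaming (_^_ to _^ᴿ_; ^-distrib-* to ^ᴿ-distrib-*)
    open import Algebra.Properties.Semiring.Mult F.semiring using () renaming (_×_ to _×ᴿ_)

    ^≡^ᴿ : ∀ x n → x ^ n ≡ x ^ᴿ n
    ^≡^ᴿ x zero    = refl
    ^≡^ᴿ x (suc n) = cong (x *_) (^≡^ᴿ x n)

    ^-distrib-* : ∀ x y n → (x * y) ^ n ≡ x ^ n * y ^ n
    ^-distrib-* x y n = trans (^≡^ᴿ (x * y) n)
      (trans (^ᴿ-distrib-* x y n) (sym (cong₂ _*_ (^≡^ᴿ x n) (^≡^ᴿ y n))))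

    ι-[] : ∀ n → ι [ n ] ≡ n ×ᴿ 1F
    ι-[] zero    = refl
    ι-[] (suc n) = trans (cong ι ([]-+ 1 n)) (trans (ι-+ 1ₚ [ n ]) (cong (1F +_) (ι-[] n)))

    p×1F≡0F : p ×ᴿ 1F ≡ 0F
    p×1F≡0F = trans (sym (ι-[] p)) (cong ι [p]≡0ₚ)

    open SemiringBinomial.CharacteristicP F.commutativeSemiring p-prime p×1F≡0F
      using (freshman's-dream; fermat)

    ^p-distrib-+ : ∀ x y → (x + y) ^ p ≡ x ^ p + y ^ p
    ^p-distrib-+ x y = trans (^≡^ᴿ (x + y) p)
      (trans (freshman's-dream x y) (sym (cong₂ _+_ (^≡^ᴿ x p) (^≡^ᴿ y p))))

    ι^p : ∀ a → ι a ^ p ≡ ι a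
    ι^p a = begin
      ι a ^ p                ≡⟨ cong (λ b → ι b ^ p) ([]-toℕ a) ⟨
      ι [ toℕ a ] ^ p        ≡⟨ ^≡^ᴿ _ p ⟩
      ι [ toℕ a ] ^ᴿ p       ≡⟨ cong (_^ᴿ p) (ι-[] (toℕ a)) ⟩
      (toℕ a ×ᴿ 1F) ^ᴿ p     ≡⟨ fermat (toℕ a) ⟩
      toℕ a ×ᴿ 1F            ≡⟨ ι-[] (toℕ a) ⟨
      ι [ toℕ a ]            ≡⟨ cong ι ([]-toℕ a) ⟩
      ι a                    ∎

    ^p-coordinates : ∀ a b → (a , b) ^ p ≡ ι a + ι b * ω ^ p
    ^p-coordinates a b = begin
      (a , b) ^ p              ≡⟨ cong (_^ p) (ι+ι*ω a b) ⟨
      (ι a + ι b * ω) ^ p      ≡⟨ ^p-distrib-+ (ι a) (ι b * ω) ⟩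
      ι a ^ p + (ι b * ω) ^ p  ≡⟨ cong (ι a ^ p +_) (^-distrib-* (ι b) ω p) ⟩
      ι a ^ p + ι b ^ p * ω ^ p ≡⟨ cong₂ (λ s t → s + t * ω ^ p) (ι^p a) (ι^p b) ⟩
      ι a + ι b * ω ^ p        ∎

    ω^p≡±ω : ω ^ p ≡ ω ⊎ ω ^ p ≡ - ω
    ω^p≡±ω = Sum.map (x-y≡0F⇒x≡y (ω ^ p) ω) (x+y≡0F⇒x≡-y (ω ^ p) ω)
      (*-integral (ω ^ p - ω) (ω ^ p + ω) (trans (difference-of-squares (ω ^ p) ω) (x≡y⇒x-y≡0F ω^p²≡ω²)))
      where
      difference-of-squares : ∀ s o → (s - o) * (s + o) ≡ s * s - o * o
      difference-of-squares = solve 2 (λ s o → (s :- o) :* (s :+ o) := s :* s :- o :* o) refl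
        where open F-Solver
      ω^p²≡ω² : ω ^ p * ω ^ p ≡ ω * ω
      ω^p²≡ω² = begin
        ω ^ p * ω ^ p     ≡⟨ ^-distrib-* ω ω p ⟨
        (ω * ω) ^ p       ≡⟨ cong (_^ p) ω*ω ⟩
        ι wₚ ^ p          ≡⟨ ι^p wₚ ⟩
        ι wₚ              ≡⟨ ω*ω ⟨
        ω * ω             ∎

  module Frobenius (p-prime : Prime p) (p≢2 : p ≢ 2) (w-nonsquare : NonSquareW)
    (β : F) (β≢0 : β ≢ 0F) (β^[p-1]≡-1 : β ^ (p ∸ 1) ≡ - 1F) where
    open Residues.PrimeModulus p p-prime
    open Field p-prime w-nonsquare

    β^p≡-β : β ^ p ≡ - β
    β^p≡-β = begin
      β ^ p              ≡⟨ cong (β ^_) p≡1+[p-1] ⟩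
      β * β ^ (p ∸ 1)    ≡⟨ cong (β *_) β^[p-1]≡-1 ⟩
      β * - 1F           ≡⟨ F.*-comm β (- 1F) ⟩
      - 1F * β           ≡⟨ -1*x≡-x β ⟩
      - β                ∎
      where
      p≡1+[p-1] : p ≡ suc (p ∸ 1)
      p≡1+[p-1] = trans (sym (ℕ.suc-pred p)) (cong suc (ℕ.pred[m∸n]≡m∸[1+n] p 0))

    -- Were Frobenius the identity, β would be fixed, contradicting β^p = -β in odd characteristic.
    ω^p≢ω : ω ^ p ≢ ω
    ω^p≢ω ω^p≡ω = β≢0 (cong₂ _,_ (≡-ₚ⇒≡0ₚ p≢2 (,-injectiveˡ β≡-β)) (≡-ₚ⇒≡0ₚ p≢2 (,-injectiveʳ β≡-β)))
      where
      β≡-β : β ≡ - β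
      β≡-β = begin
        β                                 ≡⟨ ι+ι*ω (proj₁ β) (proj₂ β) ⟨
        ι (proj₁ β) + ι (proj₂ β) * ω     ≡⟨ cong (λ t → ι (proj₁ β) + ι (proj₂ β) * t) ω^p≡ω ⟨
        ι (proj₁ β) + ι (proj₂ β) * ω ^ p ≡⟨ ^p-coordinates (proj₁ β) (proj₂ β) ⟨
        β ^ p                             ≡⟨ β^p≡-β ⟩
        - β                               ∎

    ω^p≡-ω : ω ^ p ≡ - ω
    ω^p≡-ω = Sum.[ (λ ω^p≡ω → ⊥-elim (ω^p≢ω ω^p≡ω)) , id ]′ ω^p≡±ω

    frobenius : ∀ a b → (a , b) ^ p ≡ (a , -ₚ b)
    frobenius a b = begin
      (a , b) ^ p             ≡⟨ ^p-coordinates a b ⟩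
      ι a + ι b * ω ^ p       ≡⟨ cong (λ t → ι a + ι b * t) ω^p≡-ω ⟩
      ι a + ι b * - ω         ≡⟨ cong (ι a +_) (-‿distribʳ-* (ι b) ω) ⟨
      ι a + - (ι b * ω)       ≡⟨ cong (λ t → ι a + - t) (ι*ω b) ⟩
      ι a + - (0ₚ , b)        ≡⟨ cong₂ _,_ (trans (cong (a +ₚ_) -ₚ0ₚ≡0ₚ) (Fp.+-identityʳ a)) (Fp.+-identityˡ (-ₚ b)) ⟩
      (a , -ₚ b)              ∎

    Tr≡0⇒re≡0 : ∀ z → Tr z ≡ 0F → proj₁ z ≡ 0ₚ
    Tr≡0⇒re≡0 (a , b) Tr≡0 = +ₚ-double≡0 p≢2 a (,-injectiveˡ (trans (sym (cong ((a , b) +_) (frobenius a b))) Tr≡0))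

    re≡0⇒Tr≡0 : ∀ z → proj₁ z ≡ 0ₚ → Tr z ≡ 0F
    re≡0⇒Tr≡0 (a , b) refl = trans (cong ((0ₚ , b) +_) (frobenius 0ₚ b))
      (cong₂ _,_ (Fp.+-identityˡ 0ₚ) (Fp.-‿inverseʳ b))

    re[β]≡0 : proj₁ β ≡ 0ₚ
    re[β]≡0 = ≡-ₚ⇒≡0ₚ p≢2 (,-injectiveˡ (trans (sym (frobenius (proj₁ β) (proj₂ β))) β^p≡-β))

    b : Fin p
    b = proj₂ β

    β≡bω : β ≡ ι b * ω
    β≡bω = trans (sym (ι+ι*ω (proj₁ β) b)) (trans (cong (λ c → ι c + ι b * ω) re[β]≡0) (F.+-identityˡ (ι b * ω)))

    β²≡ι[bbw] : β ^ 2 ≡ ι (b *ₚ b *ₚ wₚ)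
    β²≡ι[bbw] = begin
      β * (β * 1F)                     ≡⟨ cong (λ t → t * (t * 1F)) β≡bω ⟩
      ι b * ω * (ι b * ω * 1F)         ≡⟨ square (ι b) ω ⟩
      ι b * ι b * (ω * ω)              ≡⟨ cong₂ _*_ (ι-* b b) (sym ω*ω) ⟨
      ι (b *ₚ b) * ι wₚ                ≡⟨ ι-* (b *ₚ b) wₚ ⟨
      ι (b *ₚ b *ₚ wₚ)                 ∎
      where
      square : ∀ B O → B * O * (B * O * 1F) ≡ B * B * (O * O)
      square = solve 2 (λ B O → B :* O :* (B :* O :* con 1ℤ) := B :* B :* (O :* O)) refl
        where open F-Solver

    b≢0 : b ≢ 0ₚ
    b≢0 b≡0 = β≢0 (cong₂ _,_ re[β]≡0 b≡0)

  module PlanarFunction (p-prime : Prime p) (p≢2 : p ≢ 2) (w-nonsquare : NonSquareW)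
    (f : F → F) (f-planar : Planar f)
    (d : ℕ) (1≤d : 1 ≤ d) (f-homogeneous : ∀ μ x → f (ι μ * x) ≡ ι μ ^ d * f x) where
    open PrimeModulus p-prime
    open Field p-prime w-nonsquare

    ι-^ : ∀ a n → ι (a ^ₚ n) ≡ ι a ^ n
    ι-^ a zero    = refl
    ι-^ a (suc n) = trans (ι-* a (a ^ₚ n)) (cong (ι a *_) (ι-^ a n))

    D : Fin p → Fin p
    D l = l ^ₚ d

    f-scale : ∀ l x → f (ι l * x) ≡ ι (D l) * f x
    f-scale l x = trans (f-homogeneous l x) (cong (_* f x) (sym (ι-^ l d)))

    Δ : F → F → F
    Δ a x = f (x + a) - f x - f a

    Δ-injective : ∀ {a} → a ≢ 0F → ∀ {x y} → Δ a x ≡ Δ a y → x ≡ y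
    Δ-injective a≢0 = proj₁ (f-planar _ a≢0)

    D-zero : D 0ₚ ≡ 0ₚ
    D-zero = 0ₚ^ 1≤d
      where
      0ₚ^ : ∀ {n} → 1 ℕ.≤ n → 0ₚ ^ₚ n ≡ 0ₚ
      0ₚ^ (ℕ.s≤s _) = Fp.zeroˡ _

    D-one : D 1ₚ ≡ 1ₚ
    D-one = 1#^n≈1# Fp.semiring d

    D-nonzero⁻¹ : ∀ {c l} → c ≢ 0ₚ → c ≡ D l → l ≢ 0ₚ
    D-nonzero⁻¹ c≢0 c≡Dl l≡0 = c≢0 (trans c≡Dl (trans (cong D l≡0) D-zero))

    f-zero : f 0F ≡ 0F
    f-zero = begin
      f 0F                ≡⟨ cong f (F.zeroˡ 0F) ⟨
      f (ι 0ₚ * 0F)       ≡⟨ f-scale 0ₚ 0F ⟩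
      ι (D 0ₚ) * f 0F     ≡⟨ cong (λ c → ι c * f 0F) D-zero ⟩
      ι 0ₚ * f 0F         ≡⟨ F.zeroˡ (f 0F) ⟩
      0F                  ∎

    -1ₚ : Fin p
    -1ₚ = -ₚ 1ₚ

    f-neg : ∀ x → f (- x) ≡ ι (D -1ₚ) * f x
    f-neg x = trans (cong f (trans (sym (-1*x≡-x x)) (cong (_* x) (sym (ι-neg 1ₚ))))) (f-scale -1ₚ x)

    -1ₚ^[e+e]≡1ₚ : ∀ e → -1ₚ ^ₚ (e ℕ.+ e) ≡ 1ₚ
    -1ₚ^[e+e]≡1ₚ e = begin
      -1ₚ ^ₚ (e ℕ.+ e)          ≡⟨ ^ₚ-homo-+ -1ₚ e e ⟩
      -1ₚ ^ₚ e *ₚ -1ₚ ^ₚ e      ≡⟨ ^ₚ-distrib-*ₚ -1ₚ -1ₚ e ⟨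
      (-1ₚ *ₚ -1ₚ) ^ₚ e         ≡⟨ cong (_^ₚ e) -1ₚ*-1ₚ≡1ₚ ⟩
      1ₚ ^ₚ e                   ≡⟨ 1#^n≈1# Fp.semiring e ⟩
      1ₚ                        ∎
      where
      -1ₚ*-1ₚ≡1ₚ : -1ₚ *ₚ -1ₚ ≡ 1ₚ
      -1ₚ*-1ₚ≡1ₚ = solve 0 (:- con 1ℤ :* :- con 1ℤ := con 1ℤ) refl
        where open Fp-Solver

    -- For odd d, f would be odd and Δ₁ would vanish at both 0 and -1.
    d-even : ∃ λ e → d ≡ e ℕ.+ e
    d-even = Sum.[ id , (λ (e , d≡1+e+e) → ⊥-elim (1F≢0F (1F≡0F e d≡1+e+e))) ]′ (parity d)
      where
      1F≡0F : ∀ e → d ≡ suc (e ℕ.+ e) → 1F ≡ 0F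
      1F≡0F e d≡1+e+e = begin
        1F         ≡⟨ -‿involutive 1F ⟨
        - - 1F     ≡⟨ cong -_ (Δ-injective 1F≢0F (trans Δ[1,0]≡0 (sym Δ[1,-1]≡0))) ⟨
        - 0F       ≡⟨ -0F≡0F ⟩
        0F         ∎
        where
        open F-Solver
        D[-1]≡-1 : D -1ₚ ≡ -1ₚ
        D[-1]≡-1 = begin
          -1ₚ ^ₚ d                        ≡⟨ cong (-1ₚ ^ₚ_) d≡1+e+e ⟩
          -1ₚ *ₚ -1ₚ ^ₚ (e ℕ.+ e)         ≡⟨ cong (-1ₚ *ₚ_) (-1ₚ^[e+e]≡1ₚ e) ⟩
          -1ₚ *ₚ 1ₚ                       ≡⟨ Fp.*-identityʳ -1ₚ ⟩
          -1ₚ                             ∎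
        f[-1]≡-f[1] : f (- 1F) ≡ - f 1F
        f[-1]≡-f[1] = begin
          f (- 1F)             ≡⟨ f-neg 1F ⟩
          ι (D -1ₚ) * f 1F     ≡⟨ cong (λ c → ι c * f 1F) D[-1]≡-1 ⟩
          ι -1ₚ * f 1F         ≡⟨ cong (_* f 1F) (ι-neg 1ₚ) ⟩
          - 1F * f 1F          ≡⟨ -1*x≡-x (f 1F) ⟩
          - f 1F               ∎
        cancel₁ : ∀ a → a - 0F - a ≡ 0F
        cancel₁ = solve 1 (λ a → a :- con 0ℤ :- a := con 0ℤ) refl
        cancel₂ : ∀ a → 0F - - a - a ≡ 0F
        cancel₂ = solve 1 (λ a → con 0ℤ :- :- a :- a := con 0ℤ) refl
        Δ[1,0]≡0 : Δ 1F 0F ≡ 0F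
        Δ[1,0]≡0 = trans (cong₂ (λ s t → f s - t - f 1F) (F.+-identityˡ 1F) f-zero) (cancel₁ (f 1F))
        Δ[1,-1]≡0 : Δ 1F (- 1F) ≡ 0F
        Δ[1,-1]≡0 = trans (cong₂ (λ s t → s - t - f 1F) (trans (cong f (F.-‿inverseˡ 1F)) f-zero) f[-1]≡-f[1])
          (cancel₂ (f 1F))

    e : ℕ
    e = proj₁ d-even

    D-square : ∀ l → D l ≡ l ^ₚ e *ₚ l ^ₚ e
    D-square l = trans (cong (l ^ₚ_) (proj₂ d-even)) (^ₚ-homo-+ l e e)

    f-even : ∀ x → f (- x) ≡ f x
    f-even x = begin
      f (- x)              ≡⟨ f-neg x ⟩
      ι (D -1ₚ) * f x      ≡⟨ cong (λ c → ι c * f x) (trans (cong (-1ₚ ^ₚ_) (proj₂ d-even)) (-1ₚ^[e+e]≡1ₚ e)) ⟩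
      1F * f x             ≡⟨ F.*-identityˡ (f x) ⟩
      f x                  ∎

    f-two-to-one : ∀ y y′ → f y ≡ f y′ → y ≡ y′ ⊎ y ≡ - y′
    f-two-to-one y y′ fy≡fy′ with y ≟F y′
    ... | yes y≡y′ = inj₁ y≡y′
    ... | no  y≢y′ = inj₂ (begin
      y           ≡⟨ -‿involutive y ⟨
      - - y       ≡⟨ cong -_ y′≡-y ⟨
      - y′        ∎)
      where
      open F-Solver
      u : F
      u = y - y′
      u≢0 : u ≢ 0F
      u≢0 u≡0 = y≢y′ (x-y≡0F⇒x≡y y y′ u≡0)
      shift₁ : ∀ y y′ → y′ + (y - y′) ≡ y
      shift₁ = solve 2 (λ y y′ → y′ :+ (y :- y′) := y) refl
      shift₂ : ∀ y y′ → - y + (y - y′) ≡ - y′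
      shift₂ = solve 2 (λ y y′ → :- y :+ (y :- y′) := :- y′) refl
      cancel : ∀ a b → a - a - b ≡ - b
      cancel = solve 2 (λ a b → a :- a :- b := :- b) refl
      Δ[u,y′]≡-fu : Δ u y′ ≡ - f u
      Δ[u,y′]≡-fu = begin
        f (y′ + (y - y′)) - f y′ - f u     ≡⟨ cong (λ t → f t - f y′ - f u) (shift₁ y y′) ⟩
        f y - f y′ - f u                   ≡⟨ cong (λ t → t - f y′ - f u) fy≡fy′ ⟩
        f y′ - f y′ - f u                  ≡⟨ cancel (f y′) (f u) ⟩
        - f u                              ∎
      Δ[u,-y]≡-fu : Δ u (- y) ≡ - f u
      Δ[u,-y]≡-fu = begin
        f (- y + (y - y′)) - f (- y) - f u ≡⟨ cong₂ (λ s t → f s - t - f u) (shift₂ y y′) (f-even y) ⟩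
        f (- y′) - f y - f u               ≡⟨ cong₂ (λ s t → s - t - f u) (f-even y′) fy≡fy′ ⟩
        f y′ - f y′ - f u                  ≡⟨ cancel (f y′) (f u) ⟩
        - f u                              ∎
      y′≡-y : y′ ≡ - y
      y′≡-y = Δ-injective u≢0 (trans Δ[u,y′]≡-fu (sym Δ[u,-y]≡-fu))

    f-nonzero : ∀ {y} → y ≢ 0F → f y ≢ 0F
    f-nonzero {y} y≢0 fy≡0 = y≢0 (Sum.[ id , (λ y≡-0 → trans y≡-0 -0F≡0F) ]′
      (f-two-to-one y 0F (trans fy≡0 (sym f-zero))))

    f-ι : ∀ l → f (ι l) ≡ ι (D l) * f 1F
    f-ι l = trans (cong f (sym (F.*-identityʳ (ι l)))) (f-scale l 1F)

    D-injective-up-to-sign : ∀ {l l′} → D l ≡ D l′ → l ≡ l′ ⊎ l ≡ -ₚ l′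
    D-injective-up-to-sign {l} {l′} Dl≡Dl′ =
      Sum.map ι-injective (λ ιl≡-ιl′ → ι-injective (trans ιl≡-ιl′ (sym (ι-neg l′))))
        (f-two-to-one (ι l) (ι l′) (trans (f-ι l) (trans (cong (λ c → ι c * f 1F) Dl≡Dl′) (sym (f-ι l′)))))

    D≢w*D : ∀ l {l′} → l′ ≢ 0ₚ → D l ≢ wₚ *ₚ D l′
    D≢w*D l {l′} l′≢0 Dl≡wDl′ = nonsquare-ratio (l ^ₚ e) (^ₚ-nonzero e l′≢0)
      (trans (sym (D-square l)) (trans Dl≡wDl′ (cong (wₚ *ₚ_) (D-square l′))))

    wₚ≢0ₚ : wₚ ≢ 0ₚ
    wₚ≢0ₚ w≡0 = w-nonsquare 0ₚ (trans (Fp.zeroˡ 0ₚ) (sym w≡0))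

    Small : Fin p → Set
    Small l = toℕ l ℕ.≤ toℕ (-ₚ l)

    small-0ₚ : Small 0ₚ
    small-0ₚ = subst (λ t → toℕ 0ₚ ℕ.≤ toℕ t) (sym -ₚ0ₚ≡0ₚ) ℕ.≤-refl

    small∧small-neg⇒0ₚ : ∀ {l} → Small l → Small (-ₚ l) → l ≡ 0ₚ
    small∧small-neg⇒0ₚ {l} l≤-l -l≤l = ≡-ₚ⇒≡0ₚ p≢2 (toℕ-injective
      (ℕ.≤-antisym l≤-l (subst (λ t → toℕ (-ₚ l) ℕ.≤ toℕ t) (-ₚ-involutive l) -l≤l)))

    ¬small∧¬small-neg : ∀ {l} → ¬ Small l → ¬ Small (-ₚ l) → ⊥
    ¬small∧¬small-neg {l} l≰-l -l≰l = ℕ.<-asym (ℕ.≰⇒> l≰-l)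
      (subst (λ t → toℕ t ℕ.< toℕ (-ₚ l)) (-ₚ-involutive l) (ℕ.≰⇒> -l≰l))

    -- Ψ l is l^d on the half {l : toℕ l ≤ toℕ (-l)} of Fp and w·l^d on the other half; it is
    -- injective, hence onto, so every element of Fp is of the form l^d or w·l^d.
    Ψ′ : ∀ l → Dec (Small l) → Fin p
    Ψ′ l (yes _) = D l
    Ψ′ l (no  _) = wₚ *ₚ D l

    Ψ : Fin p → Fin p
    Ψ l = Ψ′ l (toℕ l ℕ.≤? toℕ (-ₚ l))

    Ψ′-injective : ∀ l l′ s s′ → Ψ′ l s ≡ Ψ′ l′ s′ → l ≡ l′
    Ψ′-injective l l′ (yes l-small) (yes l′-small) Dl≡Dl′ =
      Sum.[ id , (λ l≡-l′ → trans l≡-l′ (trans (cong -ₚ_ (l′≡0 l≡-l′)) (trans -ₚ0ₚ≡0ₚ (sym (l′≡0 l≡-l′))))) ]′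
        (D-injective-up-to-sign Dl≡Dl′)
      where
      l′≡0 : l ≡ -ₚ l′ → l′ ≡ 0ₚ
      l′≡0 l≡-l′ = small∧small-neg⇒0ₚ l′-small (subst Small l≡-l′ l-small)
    Ψ′-injective l l′ (no l-large) (no l′-large) wDl≡wDl′ =
      Sum.[ id , (λ l≡-l′ → ⊥-elim (¬small∧¬small-neg l′-large (subst (λ t → ¬ Small t) l≡-l′ l-large))) ]′
        (D-injective-up-to-sign (*ₚ-cancelˡ wₚ≢0ₚ wDl≡wDl′))
    Ψ′-injective l l′ (yes _) (no l′-large) Dl≡wDl′ =
      ⊥-elim (D≢w*D l (λ l′≡0 → l′-large (subst Small (sym l′≡0) small-0ₚ)) Dl≡wDl′)
    Ψ′-injective l l′ (no l-large) (yes _) wDl≡Dl′ =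
      ⊥-elim (D≢w*D l′ (λ l≡0 → l-large (subst Small (sym l≡0) small-0ₚ)) (sym wDl≡Dl′))

    Ψ′-values : ∀ l s → Ψ′ l s ≡ D l ⊎ Ψ′ l s ≡ wₚ *ₚ D l
    Ψ′-values l (yes _) = inj₁ refl
    Ψ′-values l (no  _) = inj₂ refl

    square-classes : ∀ c → (∃ λ l → c ≡ D l) ⊎ (∃ λ l → c ≡ wₚ *ₚ D l)
    square-classes c =
      Sum.map (λ Ψl≡Dl → l , trans (sym Ψl≡c) Ψl≡Dl) (λ Ψl≡wDl → l , trans (sym Ψl≡c) Ψl≡wDl)
        (Ψ′-values l (toℕ l ℕ.≤? toℕ (-ₚ l)))
      where
      Ψ-injective : ∀ {l l′} → Ψ l ≡ Ψ l′ → l ≡ l′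
      Ψ-injective {l} {l′} = Ψ′-injective l l′ (toℕ l ℕ.≤? toℕ (-ₚ l)) (toℕ l′ ℕ.≤? toℕ (-ₚ l′))
      l : Fin p
      l = proj₁ (Fin-injective⇒surjective Ψ Ψ-injective c)
      Ψl≡c : Ψ l ≡ c
      Ψl≡c = proj₂ (Fin-injective⇒surjective Ψ Ψ-injective c)

    module ZeroLines (a : F) (a≢0 : a ≢ 0F) where

      G : F → Fin p
      G y = proj₁ (a * f y)

      IsZero : F → Set
      IsZero y = G y ≡ 0ₚ

      a*f-scale : ∀ l y → a * f (ι l * y) ≡ ι (D l) * (a * f y)
      a*f-scale l y = trans (cong (a *_) (f-scale l y)) (swap a (ι (D l)) (f y))
        where
        swap : ∀ x y z → x * (y * z) ≡ y * (x * z)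
        swap = solve 3 (λ x y z → x :* (y :* z) := y :* (x :* z)) refl
          where open F-Solver

      G-scale : ∀ l y → G (ι l * y) ≡ D l *ₚ G y
      G-scale l y = trans (cong proj₁ (a*f-scale l y)) (cong proj₁ (ι-scale (D l) _ _))

      zero-scale : ∀ {z} → IsZero z → ∀ l → IsZero (ι l * z)
      zero-scale {z} Gz≡0 l = trans (G-scale l z) (trans (cong (D l *ₚ_) Gz≡0) (Fp.zeroʳ (D l)))

      zero-unscale : ∀ {z l} → l ≢ 0ₚ → IsZero (ι l * z) → IsZero z
      zero-unscale {z} {l} l≢0 Glz≡0 = Sum.[ (λ Dl≡0 → ⊥-elim (^ₚ-nonzero d l≢0 Dl≡0)) , id ]′
        (*ₚ-integral (D l) (G z) (trans (sym (G-scale l z)) Glz≡0))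

      G-Δ : ∀ u x → proj₁ (a * Δ u x) ≡ G (x + u) +ₚ -ₚ G x +ₚ -ₚ G u
      G-Δ u x = cong proj₁ (distribute a (f (x + u)) (f x) (f u))
        where
        distribute : ∀ a P Q R → a * (P - Q - R) ≡ a * P - a * Q - a * R
        distribute = solve 4 (λ a P Q R → a :* (P :- Q :- R) := a :* P :- a :* Q :- a :* R) refl
          where open F-Solver

      -- With u = μz, the values a·Δᵤ(l z) lie on the imaginary axis and are pairwise distinct, so
      -- they exhaust it; a·Δᵤ(x) is imaginary too, and Δᵤ is injective.
      level-sets-are-lines : ∀ {z} → z ≢ 0F → IsZero z → ∀ {μ} → μ ≢ 0ₚ
        → ∀ x → G (x + ι μ * z) ≡ G x → OnLine z x
      level-sets-are-lines {z} z≢0 Gz≡0 {μ} μ≢0 x G[x+u]≡Gx = l , sym (Δ-injective u≢0 (*-cancelˡ a≢0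
        (cong₂ _,_ (trans (re-φ l) (sym re-aΔx)) ψl≡im-aΔx)))
        where
        u : F
        u = ι μ * z
        u≢0 : u ≢ 0F
        u≢0 = *-nonzero (λ ιμ≡0 → μ≢0 (ι-injective ιμ≡0)) z≢0
        0-0-0 : 0ₚ +ₚ -ₚ 0ₚ +ₚ -ₚ 0ₚ ≡ 0ₚ
        0-0-0 = solve 0 (con 0ℤ :- con 0ℤ :- con 0ℤ := con 0ℤ) refl
          where open Fp-Solver
        φ : Fin p → F
        φ l = a * Δ u (ι l * z)
        re-φ : ∀ l → proj₁ (φ l) ≡ 0ₚ
        re-φ l = begin
          proj₁ (φ l)                                  ≡⟨ G-Δ u (ι l * z) ⟩
          G (ι l * z + u) +ₚ -ₚ G (ι l * z) +ₚ -ₚ G u   ≡⟨ cong₂ (λ s t → s +ₚ -ₚ t +ₚ -ₚ G u) G[lz+u]≡0 (zero-scale Gz≡0 l) ⟩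
          0ₚ +ₚ -ₚ 0ₚ +ₚ -ₚ G u                        ≡⟨ cong (λ t → 0ₚ +ₚ -ₚ 0ₚ +ₚ -ₚ t) (zero-scale Gz≡0 μ) ⟩
          0ₚ +ₚ -ₚ 0ₚ +ₚ -ₚ 0ₚ                         ≡⟨ 0-0-0 ⟩
          0ₚ                                           ∎
          where
          G[lz+u]≡0 : G (ι l * z + u) ≡ 0ₚ
          G[lz+u]≡0 = trans (cong G (ι-+-line l μ z)) (zero-scale Gz≡0 (l +ₚ μ))
        ψ : Fin p → Fin p
        ψ l = proj₂ (φ l)
        ψ-injective : ∀ {l l′} → ψ l ≡ ψ l′ → l ≡ l′
        ψ-injective {l} {l′} ψl≡ψl′ = ι*-injectiveʳ z≢0 (Δ-injective u≢0 (*-cancelˡ a≢0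
          (cong₂ _,_ (trans (re-φ l) (sym (re-φ l′))) ψl≡ψl′)))
        re-aΔx : proj₁ (a * Δ u x) ≡ 0ₚ
        re-aΔx = begin
          proj₁ (a * Δ u x)                 ≡⟨ G-Δ u x ⟩
          G (x + u) +ₚ -ₚ G x +ₚ -ₚ G u     ≡⟨ cong₂ (λ s t → s +ₚ -ₚ G x +ₚ -ₚ t) G[x+u]≡Gx (zero-scale Gz≡0 μ) ⟩
          G x +ₚ -ₚ G x +ₚ -ₚ 0ₚ            ≡⟨ cancel (G x) ⟩
          0ₚ                                ∎
          where
          cancel : ∀ g → g +ₚ -ₚ g +ₚ -ₚ 0ₚ ≡ 0ₚ
          cancel = solve 1 (λ g → g :- g :- con 0ℤ := con 0ℤ) refl
            where open Fp-Solver
        l : Fin p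
        l = proj₁ (Fin-injective⇒surjective ψ ψ-injective (proj₂ (a * Δ u x)))
        ψl≡im-aΔx : ψ l ≡ proj₂ (a * Δ u x)
        ψl≡im-aΔx = proj₂ (Fin-injective⇒surjective ψ ψ-injective (proj₂ (a * Δ u x)))

      zero-on-parallel : ∀ {z} → z ≢ 0F → IsZero z → ∀ x → ¬ OnLine z x → ∃ λ l → IsZero (x + ι l * z)
      zero-on-parallel {z} z≢0 Gz≡0 x x-off = Fin-injective⇒surjective g g-injective 0ₚ
        where
        g : Fin p → Fin p
        g l = G (x + ι l * z)
        g-injective : ∀ {l l′} → g l ≡ g l′ → l ≡ l′
        g-injective {l} {l′} gl≡gl′ with l ≟ l′
        ... | yes l≡l′ = l≡l′
        ... | no  l≢l′ = ⊥-elim (x-off (unshift-line l′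
          (level-sets-are-lines z≢0 Gz≡0 μ≢0 (x + ι l′ * z) (trans (cong G (l′+μ≡l x)) gl≡gl′))))
          where
          μ : Fin p
          μ = l +ₚ -ₚ l′
          μ≢0 : μ ≢ 0ₚ
          μ≢0 μ≡0 = l≢l′ (x-y≡0ₚ⇒x≡y l l′ μ≡0)
          l′+μ≡l : ∀ y → y + ι l′ * z + ι μ * z ≡ y + ι l * z
          l′+μ≡l y = trans (F.+-assoc y _ _) (cong (y +_) (trans (ι-+-line l′ μ z)
            (cong (λ t → ι t * z) (cancel l l′))))
            where
            cancel : ∀ l l′ → l′ +ₚ (l +ₚ -ₚ l′) ≡ l
            cancel = solve 2 (λ l l′ → l′ :+ (l :- l′) := l) refl
              where open Fp-Solver

      second-zero : ∀ {z} → z ≢ 0F → IsZero z → ∃ λ z′ → IsZero z′ × ¬ OnLine z z′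
      second-zero {z} z≢0 Gz≡0 = ω * z + ι l * z , is-zero ,
        λ (k , e) → ω+ι-off-line z≢0 l (k , trans (F.distribʳ z ω (ι l)) e)
        where
        ωz-off : ¬ OnLine z (ω * z)
        ωz-off (k , e) = ω+ι-off-line z≢0 0ₚ (k , trans (cong (_* z) (F.+-identityʳ ω)) e)
        l : Fin p
        l = proj₁ (zero-on-parallel z≢0 Gz≡0 (ω * z) ωz-off)
        is-zero : IsZero (ω * z + ι l * z)
        is-zero = proj₂ (zero-on-parallel z≢0 Gz≡0 (ω * z) ωz-off)

      zeros-on-two-lines : ∀ {z₁ z₂} → z₁ ≢ 0F → IsZero z₁ → IsZero z₂ → ¬ OnLine z₁ z₂
        → ∀ {z} → IsZero z → OnLine z₁ z ⊎ OnLine z₂ z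
      zeros-on-two-lines {z₁} {z₂} z₁≢0 Gz₁≡0 Gz₂≡0 z₂-off {z} Gz≡0 = cases (α ≟ 0ₚ) (γ ≟ 0ₚ)
        where
        decomposition : ∃ λ α → ∃ λ γ → z ≡ ι α * z₁ + ι γ * z₂
        decomposition = basis z₁≢0 z₂-off z
        α γ : Fin p
        α = proj₁ decomposition
        γ = proj₁ (proj₂ decomposition)
        z≡αz₁+γz₂ : z ≡ ι α * z₁ + ι γ * z₂
        z≡αz₁+γz₂ = proj₂ (proj₂ decomposition)
        cases : Dec (α ≡ 0ₚ) → Dec (γ ≡ 0ₚ) → OnLine z₁ z ⊎ OnLine z₂ z
        cases _ (yes γ≡0) = inj₁ (α , trans z≡αz₁+γz₂ (trans (cong (λ t → ι α * z₁ + ι t * z₂) γ≡0)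
          (trans (cong (ι α * z₁ +_) (F.zeroˡ z₂)) (F.+-identityʳ _))))
        cases (yes α≡0) _ = inj₂ (γ , trans z≡αz₁+γz₂ (trans (cong (λ t → ι t * z₁ + ι γ * z₂) α≡0)
          (trans (cong (_+ ι γ * z₂) (F.zeroˡ z₁)) (F.+-identityˡ _))))
        cases (no α≢0) (no γ≢0) = ⊥-elim (z₂-off (unscale-line γ≢0 (level-sets-are-lines z₁≢0 Gz₁≡0 α≢0 (ι γ * z₂)
          (trans (cong G (trans (F.+-comm (ι γ * z₂) (ι α * z₁)) (sym z≡αz₁+γz₂))) (trans Gz≡0 (sym (zero-scale Gz₂≡0 γ)))))))

    module ZeroCount (β : F) (β≢0 : β ≢ 0F) (β^[p-1]≡-1 : β ^ (p ∸ 1) ≡ - 1F)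
      (T : List F) (T-reps : CosetReps T) (a : F) (a≢0 : a ≢ 0F) where
      open Frobenius p-prime p≢2 w-nonsquare β β≢0 β^[p-1]≡-1
      open ZeroLines a a≢0

      T-unique : Unique T
      T-unique = proj₁ T-reps
      T-nonzero : ∀ t → t ∈ T → t ≢ 0F
      T-nonzero = proj₁ (proj₂ T-reps)
      T-covers : ∀ y → y ≢ 0F → Σ F λ t → t ∈ T × Σ (Fin p) λ μ → ι μ ≢ 0F × y ≡ ι μ * t
      T-covers = proj₁ (proj₂ (proj₂ T-reps))
      T-separates : ∀ t t′ → t ∈ T → t′ ∈ T → ∀ μ → t′ ≡ ι μ * t → t′ ≡ t
      T-separates = proj₂ (proj₂ (proj₂ T-reps))

      ∈Z⇒zero : ∀ {z} → z ∈ Z f T a → z ∈ T × IsZero z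
      ∈Z⇒zero {z} z∈Z = map₂ (Tr≡0⇒re≡0 (a * f z)) (∈-filter⁻ (λ z → Tr (a * f z) ≟F 0F) z∈Z)

      zero⇒∈Z : ∀ {z} → z ∈ T → IsZero z → z ∈ Z f T a
      zero⇒∈Z {z} z∈T Gz≡0 = ∈-filter⁺ (λ z → Tr (a * f z) ≟F 0F) z∈T (re≡0⇒Tr≡0 (a * f z) Gz≡0)

      length≡2-if-nonempty : ∀ {z₁} → z₁ ∈ Z f T a → length (Z f T a) ≡ 2
      length≡2-if-nonempty {z₁} z₁∈Z = length≡2 (Unique.filter⁺ (λ z → Tr (a * f z) ≟F 0F) T-unique)
        z₁≢z₂ z₁∈Z (zero⇒∈Z z₂∈T z₂-zero) (λ x∈Z → Sum.map (representative x∈Z z₁∈T) (representative x∈Z z₂∈T)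
          (zeros-on-two-lines z₁≢0 z₁-zero z₂-zero z₂-off (proj₂ (∈Z⇒zero x∈Z))))
        where
        z₁∈T : z₁ ∈ T
        z₁∈T = proj₁ (∈Z⇒zero z₁∈Z)
        z₁-zero : IsZero z₁
        z₁-zero = proj₂ (∈Z⇒zero z₁∈Z)
        z₁≢0 : z₁ ≢ 0F
        z₁≢0 = T-nonzero z₁ z₁∈T
        y : F
        y = proj₁ (second-zero z₁≢0 z₁-zero)
        y-zero : IsZero y
        y-zero = proj₁ (proj₂ (second-zero z₁≢0 z₁-zero))
        y-off : ¬ OnLine z₁ y
        y-off = proj₂ (proj₂ (second-zero z₁≢0 z₁-zero))
        y≢0 : y ≢ 0F
        y≢0 y≡0 = y-off (0ₚ , trans y≡0 (sym (F.zeroˡ z₁)))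
        z₂ : F
        z₂ = proj₁ (T-covers y y≢0)
        z₂∈T : z₂ ∈ T
        z₂∈T = proj₁ (proj₂ (T-covers y y≢0))
        ν : Fin p
        ν = proj₁ (proj₂ (proj₂ (T-covers y y≢0)))
        ιν≢0 : ι ν ≢ 0F
        ιν≢0 = proj₁ (proj₂ (proj₂ (proj₂ (T-covers y y≢0))))
        y≡νz₂ : y ≡ ι ν * z₂
        y≡νz₂ = proj₂ (proj₂ (proj₂ (proj₂ (T-covers y y≢0))))
        z₂-zero : IsZero z₂
        z₂-zero = zero-unscale (λ ν≡0 → ιν≢0 (cong ι ν≡0)) (subst IsZero y≡νz₂ y-zero)
        z₂-off : ¬ OnLine z₁ z₂
        z₂-off z₂-on-line = y-off (subst (OnLine z₁) (sym y≡νz₂) (scale-line ν z₂-on-line))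
        z₁≢z₂ : z₁ ≢ z₂
        z₁≢z₂ z₁≡z₂ = z₂-off (1ₚ , trans (sym z₁≡z₂) (sym (F.*-identityˡ z₁)))
        representative : ∀ {x t} → x ∈ Z f T a → t ∈ T → OnLine t x → x ≡ t
        representative {x} {t} x∈Z t∈T (k , x≡kt) = T-separates t x t∈T (proj₁ (∈Z⇒zero x∈Z)) k x≡kt

      |Z|≡0∨2 : length (Z f T a) ≡ 0 ⊎ length (Z f T a) ≡ 2
      |Z|≡0∨2 with Z f T a in Z≡
      ... | []    = inj₁ refl
      ... | z ∷ _ = inj₂ (trans (cong length (sym Z≡)) (length≡2-if-nonempty (subst (z ∈_) (sym Z≡) (here refl))))

    module Correspondence (β : F) (β≢0 : β ≢ 0F) (β^[p-1]≡-1 : β ^ (p ∸ 1) ≡ - 1F)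
      (x : F) (x≢0 : x ≢ 0F) where
      open Frobenius p-prime p≢2 w-nonsquare β β≢0 β^[p-1]≡-1

      -- The witnesses below stay opaque: unfolding them makes conversion checking evaluate the
      -- search over Fin p behind each existential.
      opaque
        fx′ : F
        fx′ = proj₁ (*-inverseˡ (f-nonzero x≢0))
        fx′fx≡1 : fx′ * f x ≡ 1F
        fx′fx≡1 = proj₂ (*-inverseˡ (f-nonzero x≢0))

      a : F
      a = ω * fx′

      a*fx≡ω : a * f x ≡ ω
      a*fx≡ω = trans (F.*-assoc ω fx′ (f x)) (trans (cong (ω *_) fx′fx≡1) (F.*-identityʳ ω))

      a≢0 : a ≢ 0F
      a≢0 a≡0 = ω≢0 (trans (sym a*fx≡ω) (trans (cong (_* f x) a≡0) (F.zeroˡ (f x))))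

      open ZeroLines a a≢0

      x-zero : IsZero x
      x-zero = cong proj₁ a*fx≡ω

      opaque
        z : F
        z = proj₁ (second-zero x≢0 x-zero)
        z-zero : IsZero z
        z-zero = proj₁ (proj₂ (second-zero x≢0 x-zero))
        z-off : ¬ OnLine x z
        z-off = proj₂ (proj₂ (second-zero x≢0 x-zero))

      z≢0 : z ≢ 0F
      z≢0 z≡0 = z-off (0ₚ , trans z≡0 (sym (F.zeroˡ x)))

      r : Fin p
      r = proj₂ (a * f z)

      a*fz≡rω : a * f z ≡ ι r * ω
      a*fz≡rω = trans (cong (_, r) z-zero) (sym (ι*ω r))

      r≢0 : r ≢ 0ₚ
      r≢0 r≡0 = *-nonzero a≢0 (f-nonzero z≢0) (trans a*fz≡rω (trans (cong (λ c → ι c * ω) r≡0) (F.zeroˡ ω)))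

      a*f-on-x-line : ∀ l → a * f (ι l * x) ≡ ι (D l) * ω
      a*f-on-x-line l = trans (a*f-scale l x) (cong (ι (D l) *_) a*fx≡ω)

      a*f-on-z-line : ∀ k → a * f (ι k * z) ≡ ι (D k *ₚ r) * ω
      a*f-on-z-line k = trans (a*f-scale k z) (trans (cong (ι (D k) *_) a*fz≡rω)
        (trans (sym (F.*-assoc (ι (D k)) (ι r) ω)) (cong (_* ω) (sym (ι-* (D k) r)))))

      lines-apart : ∀ l {k} → k ≢ 0ₚ → ι l * x ≢ ι k * z
      lines-apart l k≢0 lx≡kz = z-off (unscale-line k≢0 (l , sym lx≡kz))

      values-apart : ∀ l {k} → k ≢ 0ₚ → D l ≢ D k *ₚ r
      values-apart l {k} k≢0 Dl≡Dkr =
        Sum.[ lines-apart l k≢0 , (λ lx≡-kz → lines-apart l -k≢0 (trans lx≡-kz -kz≡[-k]z)) ]′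
        (f-two-to-one (ι l * x) (ι k * z) (*-cancelˡ a≢0 (begin
          a * f (ι l * x)      ≡⟨ a*f-on-x-line l ⟩
          ι (D l) * ω          ≡⟨ cong (λ c → ι c * ω) Dl≡Dkr ⟩
          ι (D k *ₚ r) * ω     ≡⟨ a*f-on-z-line k ⟨
          a * f (ι k * z)      ∎)))
        where
        -k≢0 : -ₚ k ≢ 0ₚ
        -k≢0 -k≡0 = k≢0 (trans (sym (-ₚ-involutive k)) (trans (cong -ₚ_ -k≡0) -ₚ0ₚ≡0ₚ))
        -kz≡[-k]z : - (ι k * z) ≡ ι (-ₚ k) * z
        -kz≡[-k]z = trans (-‿distribˡ-* (ι k) z) (cong (_* z) (sym (ι-neg k)))

      r′ : Fin p
      r′ = proj₁ (*ₚ-inverse r≢0)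

      r′r≡1 : r′ *ₚ r ≡ 1ₚ
      r′r≡1 = trans (Fp.*-comm r′ r) (proj₂ (*ₚ-inverse r≢0))

      r′≢0 : r′ ≢ 0ₚ
      r′≢0 r′≡0 = 1ₚ≢0ₚ (trans (sym r′r≡1) (trans (cong (_*ₚ r) r′≡0) (Fp.zeroˡ r)))

      r′-nonsquare : ∃ λ λ′ → r′ ≡ wₚ *ₚ D λ′
      r′-nonsquare = Sum.[ (λ (l , r′≡Dl) → ⊥-elim (values-apart 1ₚ (D-nonzero⁻¹ r′≢0 r′≡Dl)
        (trans D-one (trans (sym r′r≡1) (cong (_*ₚ r) r′≡Dl))))) , id ]′ (square-classes r′)

      bb≢0 : b *ₚ b ≢ 0ₚ
      bb≢0 bb≡0 = b≢0 (reduce (*ₚ-integral b b bb≡0))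

      bb-square : ∃ λ κ → b *ₚ b ≡ D κ
      bb-square = Sum.[ id , (λ (κ , bb≡wDκ) → ⊥-elim (nonsquare-ratio b (^ₚ-nonzero e (κ≢0 bb≡wDκ))
        (trans bb≡wDκ (cong (wₚ *ₚ_) (D-square κ))))) ]′ (square-classes (b *ₚ b))
        where
        κ≢0 : ∀ {κ} → b *ₚ b ≡ wₚ *ₚ D κ → κ ≢ 0ₚ
        κ≢0 bb≡wDκ κ≡0 = bb≢0 (trans bb≡wDκ (trans (cong (λ l → wₚ *ₚ D l) κ≡0)
          (trans (cong (wₚ *ₚ_) D-zero) (Fp.zeroʳ wₚ))))

      opaque
        κ : Fin p
        κ = proj₁ bb-square
        bb≡Dκ : b *ₚ b ≡ D κ
        bb≡Dκ = proj₂ bb-square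
        κ′ : Fin p
        κ′ = proj₁ (*ₚ-inverse (D-nonzero⁻¹ bb≢0 bb≡Dκ))
        κκ′≡1 : κ *ₚ κ′ ≡ 1ₚ
        κκ′≡1 = proj₂ (*ₚ-inverse (D-nonzero⁻¹ bb≢0 bb≡Dκ))
        λ′ : Fin p
        λ′ = proj₁ r′-nonsquare
        r′≡wDλ′ : r′ ≡ wₚ *ₚ D λ′
        r′≡wDλ′ = proj₂ r′-nonsquare

      θ : Fin p
      θ = λ′ *ₚ κ′

      x* : F
      x* = ι θ * z

      coefficient≡1 : (b *ₚ b *ₚ wₚ) *ₚ (D θ *ₚ r) ≡ 1ₚ
      coefficient≡1 = begin
        (b *ₚ b *ₚ wₚ) *ₚ (D θ *ₚ r)     ≡⟨ cong (λ c → (c *ₚ wₚ) *ₚ (D θ *ₚ r)) bb≡Dκ ⟩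
        (D κ *ₚ wₚ) *ₚ (D θ *ₚ r)        ≡⟨ regroup (D κ) wₚ (D θ) r ⟩
        wₚ *ₚ (D κ *ₚ D θ) *ₚ r          ≡⟨ cong (λ c → wₚ *ₚ c *ₚ r) (^ₚ-distrib-*ₚ κ θ d) ⟨
        wₚ *ₚ D (κ *ₚ θ) *ₚ r            ≡⟨ cong (λ c → wₚ *ₚ D c *ₚ r) κθ≡λ′ ⟩
        wₚ *ₚ D λ′ *ₚ r                  ≡⟨ cong (_*ₚ r) r′≡wDλ′ ⟨
        r′ *ₚ r                          ≡⟨ r′r≡1 ⟩
        1ₚ                               ∎
        where
        open Fp-Solver
        regroup : ∀ K W T R → (K *ₚ W) *ₚ (T *ₚ R) ≡ W *ₚ (K *ₚ T) *ₚ R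
        regroup = solve 4 (λ K W T R → (K :* W) :* (T :* R) := W :* (K :* T) :* R) refl
        κθ≡λ′ : κ *ₚ θ ≡ λ′
        κθ≡λ′ = begin
          κ *ₚ (λ′ *ₚ κ′)     ≡⟨ swap κ λ′ κ′ ⟩
          λ′ *ₚ (κ *ₚ κ′)     ≡⟨ cong (λ′ *ₚ_) κκ′≡1 ⟩
          λ′ *ₚ 1ₚ            ≡⟨ Fp.*-identityʳ λ′ ⟩
          λ′                  ∎
          where
          swap : ∀ x y z → x *ₚ (y *ₚ z) ≡ y *ₚ (x *ₚ z)
          swap = solve 3 (λ x y z → x :* (y :* z) := y :* (x :* z)) refl

      fx≡β²fx* : f x ≡ β ^ 2 * f x*
      fx≡β²fx* = *-cancelˡ a≢0 (begin
        a * f x                                   ≡⟨ a*fx≡ω ⟩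
        ω                                         ≡⟨ F.*-identityˡ ω ⟨
        ι 1ₚ * ω                                  ≡⟨ cong (λ c → ι c * ω) coefficient≡1 ⟨
        ι ((b *ₚ b *ₚ wₚ) *ₚ (D θ *ₚ r)) * ω       ≡⟨ cong (_* ω) (ι-* (b *ₚ b *ₚ wₚ) (D θ *ₚ r)) ⟩
        ι (b *ₚ b *ₚ wₚ) * ι (D θ *ₚ r) * ω        ≡⟨ F.*-assoc (ι (b *ₚ b *ₚ wₚ)) (ι (D θ *ₚ r)) ω ⟩
        ι (b *ₚ b *ₚ wₚ) * (ι (D θ *ₚ r) * ω)      ≡⟨ cong₂ _*_ β²≡ι[bbw] (a*f-on-z-line θ) ⟨
        β ^ 2 * (a * f x*)                        ≡⟨ swap (β ^ 2) a (f x*) ⟩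
        a * (β ^ 2 * f x*)                        ∎)
        where
        swap : ∀ x y z → x * (y * z) ≡ y * (x * z)
        swap = solve 3 (λ x y z → x :* (y :* z) := y :* (x :* z)) refl
          where open F-Solver

      x*≢0 : x* ≢ 0F
      x*≢0 x*≡0 = f-nonzero x≢0 (trans fx≡β²fx* (trans (cong (λ t → β ^ 2 * f t) x*≡0)
        (trans (cong (β ^ 2 *_) f-zero) (F.zeroʳ (β ^ 2)))))

      x*-unique : ∀ y → y ≢ 0F → f x ≡ β ^ 2 * f y → y ≡ x* ⊎ y ≡ - x*
      x*-unique y _ fx≡β²fy = f-two-to-one y x* (*-cancelˡ β²≢0 (trans (sym fx≡β²fy) fx≡β²fx*))
        where
        β²≢0 : β ^ 2 ≢ 0F
        β²≢0 = *-nonzero β≢0 (λ β1≡0 → β≢0 (trans (sym (F.*-identityʳ β)) β1≡0))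

lemma2p3 : (p : ℕ) .{{_ : NonZero p}} → Prime p → p ≢ 2
    → (w : ℕ) → FF.NonSquareW p w
    → let open FF p w in
      (f : F → F) → Planar f → f 1F ≡ 1F
    → (d : ℕ) → 1 ≤ d → ((μ : Fp) (x : F) → f (ι μ * x) ≡ (ι μ) ^ d * f x)
    → (T : List F) → CosetReps T
    → (β : F) → β ≢ 0F → β ^ (p ∸ 1) ≡ - 1F
    → ((a : F) → a ≢ 0F → length (Z f T a) ≡ 0 ⊎ length (Z f T a) ≡ 2)
      × ((x : F) → x ≢ 0F →
          Σ F λ xs → xs ≢ 0F × f x ≡ β ^ 2 * f xs
            × ((y : F) → y ≢ 0F → f x ≡ β ^ 2 * f y → y ≡ xs ⊎ y ≡ - xs))
lemma2p3 p p-prime p≢2 w w-nonsquare f f-planar _ d 1≤d f-homogeneous T T-reps β β≢0 β^[p-1]≡-1 =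
  (λ a a≢0 → ZeroCount.|Z|≡0∨2 β β≢0 β^[p-1]≡-1 T T-reps a a≢0) ,
  (λ x x≢0 → let open Correspondence β β≢0 β^[p-1]≡-1 x x≢0 in x* , x*≢0 , fx≡β²fx* , x*-unique)
  where open QuadraticExtension.PlanarFunction p w p-prime p≢2 w-nonsquare f f-planar d 1≤d f-homogeneous
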